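{- Let $q$ be a prime power, $G={\rm PGL}(3,q)$, let $\mathcal B$ be a circumscribed bundle of ${\rm PG}(2,q)$ and let $\mathcal B^G$ be its orbit under $G$. Then two distinct circumscribed bundles in $\mathcal B^G$ share at most one conic.
   Context: Embed ${\rm PG}(2,q)$ in ${\rm PG}(2,q^3)$ and let $\sigma$ be the collineation induced by $x\mapsto x^q$. For a point $P$ of ${\rm PG}(2,q^3)$ with $P,P^\sigma,P^{\sigma^2}$ not collinear, the circumscribed bundle determined by the triangle $P,P^\sigma,P^{\sigma^2}$ is the set of all conics (non-degenerate quadrics) of ${\rm PG}(2,q)$ whose extension to ${\rm PG}(2,q^3)$ contains $P,P^\sigma,P^{\sigma^2}$. $G$ acts on the set of conics of ${\rm PG}(2,q)$ naturally. -}

module Defs where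

open import Data.Nat as ℕ using (ℕ; zero; suc)
import Data.Fin
open import Data.Fin using (Fin)
import Relation.Nullary
open import Data.Product using (Σ; _×_; _,_)
open import Relation.Nullary using (¬_)
open import Relation.Binary.PropositionalEquality using (_≡_)
open import Algebra.Structures using (IsCommutativeRing)
open import Function.Bundles using (_⤖_)

record FiniteField (N : ℕ) : Set₁ where
  infixl 6 _+_ _-_
  infixl 7 _*_
  field
    K     : Set
    _+_   : K → K → K
    _*_   : K → K → K
    -_    : K → K
    0#    : K
    1#    : K
    isCommutativeRing : IsCommutativeRing _≡_ _+_ _*_ -_ 0# 1#
    0≢1   : ¬ (0# ≡ 1#)
    inverse : ∀ x → ¬ (x ≡ 0#) → Σ K (λ y → x * y ≡ 1#)
    card  : K ⤖ Fin N

  _-_ : K → K → K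
  x - y = x + (- y)

  _^_ : K → ℕ → K
  x ^ zero  = 1#
  x ^ suc n = x * (x ^ n)

-- Geometry of PG(2,q) ⊆ PG(2,K), K = GF(q^3), σ : x ↦ x^q.

module Geometry {N : ℕ} (𝔽 : FiniteField N) (q : ℕ) where
  open FiniteField 𝔽

  frob : K → K
  frob x = x ^ q

  -- x lies in the subfield GF(q) = fixed field of σ
  InSub : K → Set
  InSub x = frob x ≡ x

  -- homogeneous coordinates (x₀ , x₁ , x₂) of a point of PG(2,K)
  V3 : Set
  V3 = K × K × K

  σ : V3 → V3
  σ (x , y , z) = frob x , frob y , frob z

  det3 : V3 → V3 → V3 → K
  det3 (a₁ , a₂ , a₃) (b₁ , b₂ , b₃) (c₁ , c₂ , c₃) =
      a₁ * (b₂ * c₃ - b₃ * c₂)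
    - a₂ * (b₁ * c₃ - b₃ * c₁)
    + a₃ * (b₁ * c₂ - b₂ * c₁)

  -- three points (nonzero vectors) that are not collinear
  -- (det ≠ 0 also forces each vector to be nonzero)
  NonCollinear : V3 → V3 → V3 → Set
  NonCollinear u v w = ¬ (det3 u v w ≡ 0#)

  record Form : Set where
    constructor form
    field a b c f g h : K
  open Form public

  eval : Form → V3 → K
  eval Q (x , y , z) =
    a Q * (x * x) + b Q * (y * y) + c Q * (z * z)
    + f Q * (y * z) + g Q * (x * z) + h Q * (x * y)

  four : K
  four = 1# + 1# + 1# + 1#

  -- (half-)discriminant; non-degenerate iff nonzero (valid in every characteristic)
  disc : Form → K
  disc Q = four * a Q * b Q * c Q - a Q * (f Q * f Q) - b Q * (g Q * g Q)
           - c Q * (h Q * h Q) + f Q * g Q * h Q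

  IsConic : Form → Set
  IsConic Q = InSub (a Q) × InSub (b Q) × InSub (c Q)
            × InSub (f Q) × InSub (g Q) × InSub (h Q)
            × ¬ (disc Q ≡ 0#)

  SameConic : Form → Form → Set
  SameConic Q R = Σ K λ λ' → ¬ (λ' ≡ 0#) ×
    (a R ≡ λ' * a Q) × (b R ≡ λ' * b Q) × (c R ≡ λ' * c Q) ×
    (f R ≡ λ' * f Q) × (g R ≡ λ' * g Q) × (h R ≡ λ' * h Q)

  -- circumscribed bundle of the triangle P, P^σ, P^σ² : conics whose
  -- extension to PG(2,K) contains the three points
  InBundle : V3 → Form → Set
  InBundle P Q = IsConic Q × eval Q P ≡ 0# × eval Q (σ P) ≡ 0#
                 × eval Q (σ (σ P)) ≡ 0#

  Mat : Set
  Mat = Fin 3 → Fin 3 → K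

  matDet : Mat → K
  matDet M = det3 (M 0F 0F , M 0F 1F , M 0F 2F)
                  (M 1F 0F , M 1F 1F , M 1F 2F)
                  (M 2F 0F , M 2F 1F , M 2F 2F)
    where
    0F 1F 2F : Fin 3
    0F = Fin.zero
    1F = Fin.suc Fin.zero
    2F = Fin.suc (Fin.suc Fin.zero)

  -- element of GL(3,q) (representing an element of PGL(3,q))
  InGL : Mat → Set
  InGL M = (∀ i j → InSub (M i j)) × ¬ (matDet M ≡ 0#)

  mulV : Mat → V3 → V3
  mulV M (x , y , z) =
    (M i0 i0 * x + M i0 i1 * y + M i0 i2 * z) ,
    (M i1 i0 * x + M i1 i1 * y + M i1 i2 * z) ,
    (M i2 i0 * x + M i2 i1 * y + M i2 i2 * z)
    where
    i0 i1 i2 : Fin 3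
    i0 = Fin.zero
    i1 = Fin.suc Fin.zero
    i2 = Fin.suc (Fin.suc Fin.zero)

  -- the form X ↦ Q(M X), coefficients written out:
  -- writing r_i for the i-th row of M as linear form ℓ_i(X) = r_i · X,
  -- Q(MX) = a ℓ₀² + b ℓ₁² + c ℓ₂² + f ℓ₁ℓ₂ + g ℓ₀ℓ₂ + h ℓ₀ℓ₁.
  pull : Form → Mat → Form
  pull Q M = form (co i0 i0) (co i1 i1) (co i2 i2) (co i1 i2) (co i0 i2) (co i0 i1)
    where
    i0 i1 i2 : Fin 3
    i0 = Fin.zero
    i1 = Fin.suc Fin.zero
    i2 = Fin.suc (Fin.suc Fin.zero)
    -- coefficient of X_k X_l in ℓ_i ℓ_j  (for k = l: of X_k²)
    pc : Fin 3 → Fin 3 → Fin 3 → Fin 3 → K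
    pc i j k l with Data.Fin._≟_ k l
    ... | Relation.Nullary.yes _ = M i k * M j k
    ... | Relation.Nullary.no  _ = M i k * M j l + M i l * M j k
    co : Fin 3 → Fin 3 → K
    co k l = a Q * pc i0 i0 k l + b Q * pc i1 i1 k l + c Q * pc i2 i2 k l
           + f Q * pc i1 i2 k l + g Q * pc i0 i2 k l + h Q * pc i0 i1 k l

  -- the image B^M of the bundle of P under the collineation induced by M⁻¹
  -- (the conic {Q = 0} is sent by M⁻¹ ... i.e. D ↦ D^{M⁻¹} = {X : D(MX) = 0});
  -- as M ranges over GL(3,q) these are exactly the members of the orbit B^G.
  InImage : V3 → Mat → Form → Set
  InImage P M Q = InBundle P (pull Q M)

module Submission where

-- The bundle B^M is the set of conics of PG(2,q) through the triangle
-- M·Δ, Δ = (P, σP, σ²P).  As M has entries in GF(q), σ commutes with M,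
-- and since σ³ = 1 on K = GF(q³) it permutes the vertices of M·Δ
-- cyclically.  Hence if M₁Δ and M₂Δ had one vertex in common they would
-- have all three in common, and B^{M₁} = B^{M₂}.  Otherwise two conics
-- common to both bundles pass through the vertices U₀, U₁, U₂ of M₁Δ
-- and through two further distinct points V₀, V₁ of M₂Δ; in the frame
-- U₀, U₁, U₂ such conics read f yz + g xz + h xy = 0, and they coincide.

open import Defs
open import Level using (0ℓ)
open import Data.Nat as ℕ using (ℕ; zero; suc; _∸_)
open import Data.Nat.Primality using (Prime; euclidsLemma; prime⇒nonZero; prime⇒nonTrivial)
import Data.Nat.Properties as ℕP
import Data.Fin.Properties as FinP
open import Data.Integer as ℤ using (ℤ; -[1+_]; _⊖_) renaming (+_ to ⁺_)
import Data.Integer.Properties as ℤP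
open import Data.Maybe using (Maybe; just; nothing)
open import Data.Fin as Fin using (Fin; #_)
open import Data.Vec as Vec using (Vec; []; _∷_)
import Data.Vec.Properties as VecP
open import Data.Vec.N-ary using (N-ary)
open import Data.Product using (Σ; _×_; _,_; proj₁; proj₂)
open import Data.Product.Properties using () renaming (≡-dec to ×-≡-dec)
open import Data.Sum using (_⊎_; inj₁; inj₂)
open import Data.Empty using (⊥-elim)
open import Relation.Nullary using (¬_; Dec; yes; no)
open import Relation.Nullary.Decidable using (map′)
open import Relation.Binary.Definitions using (DecidableEquality)
open import Relation.Binary.PropositionalEquality
open import Function.Bundles using (Bijection)
open import Algebra.Bundles using (CommutativeRing; CommutativeMonoid; RawRing)
import Algebra.Properties.CommutativeMonoid.Sum as Sum
open import Data.Fin.Permutation using (Permutation′; permutation)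
open import Function.Base using (id; _∘_)
open import Data.Fin.Patterns using (0F; 1F; 2F)
open import Algebra.Solver.Ring.AlmostCommutativeRing using (_-Raw-AlmostCommutative⟶_; fromCommutativeRing)

-- Elementary algebra in the field K.

module FieldAlgebra {N : ℕ} (𝔽 : FiniteField N) where
  open FiniteField 𝔽 public

  commutativeRing : CommutativeRing 0ℓ 0ℓ
  commutativeRing = record { isCommutativeRing = isCommutativeRing }

  open CommutativeRing commutativeRing public
    using ( +-assoc; +-comm; +-identityˡ; +-identityʳ; -‿inverseˡ; -‿inverseʳ
          ; *-assoc; *-comm; *-identityˡ; *-identityʳ; distribˡ; distribʳ; zeroˡ; zeroʳ
          ; ring; semiring; +-group; +-commutativeMonoid; *-commutativeMonoid )
  open import Algebra.Properties.Ring ring public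
    using (-‿distribˡ-*; -‿distribʳ-*; x[y-z]≈xy-xz)
  open import Algebra.Properties.Group +-group public
    using (x∙y⁻¹≈ε⇒x≈y; inverseʳ-unique; identityˡ-unique; ε⁻¹≈ε; ⁻¹-involutive)
  open import Algebra.Properties.AbelianGroup (CommutativeRing.+-abelianGroup commutativeRing) public
    using (⁻¹-∙-comm)
  open import Algebra.Properties.CommutativeSemigroup (CommutativeRing.*-commutativeSemigroup commutativeRing) public
    using (x∙yz≈y∙xz)
  open ≡-Reasoning

  _≟_ : DecidableEquality K
  x ≟ y = map′ (Bijection.injective card) (cong (Bijection.to card))
               (Bijection.to card x Fin.≟ Bijection.to card y)

  zero-product : ∀ x y → x * y ≡ 0# → x ≡ 0# ⊎ y ≡ 0#
  zero-product x y xy≡0 with x ≟ 0#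
  ... | yes x≡0 = inj₁ x≡0
  ... | no  x≢0 = inj₂ (begin
    y                ≡⟨ sym (*-identityˡ y) ⟩
    1# * y           ≡⟨ cong (_* y) (sym (trans (*-comm x⁻¹ x) x*x⁻¹≡1)) ⟩
    (x⁻¹ * x) * y    ≡⟨ *-assoc x⁻¹ x y ⟩
    x⁻¹ * (x * y)    ≡⟨ cong (x⁻¹ *_) xy≡0 ⟩
    x⁻¹ * 0#         ≡⟨ zeroʳ x⁻¹ ⟩
    0#               ∎)
    where
    x⁻¹ = proj₁ (inverse x x≢0)
    x*x⁻¹≡1 = proj₂ (inverse x x≢0)

  *-nonzero : ∀ {x y} → x ≢ 0# → y ≢ 0# → x * y ≢ 0#
  *-nonzero {x} {y} x≢0 y≢0 xy≡0 with zero-product x y xy≡0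
  ... | inj₁ x≡0 = x≢0 x≡0
  ... | inj₂ y≡0 = y≢0 y≡0

  *-cancel-≡0 : ∀ {t x} → t ≢ 0# → t * x ≡ 0# → x ≡ 0#
  *-cancel-≡0 {t} {x} t≢0 tx≡0 with zero-product t x tx≡0
  ... | inj₁ t≡0 = ⊥-elim (t≢0 t≡0)
  ... | inj₂ x≡0 = x≡0

  *-cancelˡ : ∀ {t x y} → t ≢ 0# → t * x ≡ t * y → x ≡ y
  *-cancelˡ {t} {x} {y} t≢0 tx≡ty = x∙y⁻¹≈ε⇒x≈y x y (*-cancel-≡0 t≢0 (begin
    t * (x - y)       ≡⟨ x[y-z]≈xy-xz t x y ⟩
    t * x - t * y     ≡⟨ cong (_- t * y) tx≡ty ⟩
    t * y - t * y     ≡⟨ -‿inverseʳ (t * y) ⟩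
    0#                ∎))

  -- Powers: Defs' x ^ n agrees with the library's, whose laws we reuse.
  open import Algebra.Properties.Semiring.Exp semiring public using () renaming (_^_ to _^ₛ_)
  open import Algebra.Properties.Semiring.Exp semiring using (^-assocʳ)
  open import Algebra.Properties.CommutativeSemiring.Exp (CommutativeRing.commutativeSemiring commutativeRing)
    using (^-distrib-*)

  ^-agrees : ∀ x n → x ^ n ≡ x ^ₛ n
  ^-agrees x zero    = refl
  ^-agrees x (suc n) = cong (x *_) (^-agrees x n)

  ^-* : ∀ x m k → x ^ (m ℕ.* k) ≡ (x ^ m) ^ k
  ^-* x m k = begin
    x ^ (m ℕ.* k)      ≡⟨ ^-agrees x (m ℕ.* k) ⟩
    x ^ₛ (m ℕ.* k)     ≡⟨ sym (^-assocʳ x m k) ⟩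
    (x ^ₛ m) ^ₛ k      ≡⟨ sym (trans (^-agrees (x ^ m) k) (cong (_^ₛ k) (^-agrees x m))) ⟩
    (x ^ m) ^ k        ∎

  *-^ : ∀ x y k → (x * y) ^ k ≡ x ^ k * y ^ k
  *-^ x y k = begin
    (x * y) ^ k        ≡⟨ ^-agrees (x * y) k ⟩
    (x * y) ^ₛ k       ≡⟨ ^-distrib-* x y k ⟩
    x ^ₛ k * y ^ₛ k    ≡⟨ sym (cong₂ _*_ (^-agrees x k) (^-agrees y k)) ⟩
    x ^ k * y ^ k      ∎

  ^-≡0 : ∀ x k → x ^ k ≡ 0# → x ≡ 0#
  ^-≡0 x zero    1≡0 = ⊥-elim (0≢1 (sym 1≡0))
  ^-≡0 x (suc k) xᵏ⁺¹≡0 with zero-product x (x ^ k) xᵏ⁺¹≡0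
  ... | inj₁ x≡0  = x≡0
  ... | inj₂ xᵏ≡0 = ^-≡0 x k xᵏ≡0

  +-sub-interchange : ∀ a b c d → (a + c) - (b + d) ≡ (a - b) + (c - d)
  +-sub-interchange a b c d = begin
    (a + c) + - (b + d)       ≡⟨ cong ((a + c) +_) (sym (⁻¹-∙-comm b d)) ⟩
    (a + c) + (- b + - d)     ≡⟨ +-assoc a c (- b + - d) ⟩
    a + (c + (- b + - d))     ≡⟨ cong (a +_) (sym (+-assoc c (- b) (- d))) ⟩
    a + ((c + - b) + - d)     ≡⟨ cong (λ z → a + (z + - d)) (+-comm c (- b)) ⟩
    a + ((- b + c) + - d)     ≡⟨ cong (a +_) (+-assoc (- b) c (- d)) ⟩
    a + (- b + (c + - d))     ≡⟨ sym (+-assoc a (- b) (c + - d)) ⟩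
    (a + - b) + (c + - d)     ∎

  *-sub-expand : ∀ a b c d → (a - b) * (c - d) ≡ (a * c + b * d) - (a * d + b * c)
  *-sub-expand a b c d = begin
    (a - b) * (c - d)                              ≡⟨ distribʳ (c - d) a (- b) ⟩
    a * (c - d) + - b * (c - d)                    ≡⟨ cong₂ _+_ (x[y-z]≈xy-xz a c d) (distribˡ (- b) c (- d)) ⟩
    (a * c - a * d) + (- b * c + - b * - d)        ≡⟨ cong₂ (λ u v → (a * c - a * d) + (u + v))
                                                        (sym (-‿distribˡ-* b c)) neg*neg ⟩
    (a * c - a * d) + (- (b * c) + b * d)          ≡⟨ cong ((a * c - a * d) +_) (+-comm (- (b * c)) (b * d)) ⟩
    (a * c - a * d) + (b * d - b * c)              ≡⟨ sym (+-sub-interchange (a * c) (a * d) (b * d) (b * c)) ⟩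
    (a * c + b * d) - (a * d + b * c)              ∎
    where
    neg*neg : - b * - d ≡ b * d
    neg*neg = trans (sym (-‿distribˡ-* b (- d)))
                    (trans (cong -_ (sym (-‿distribʳ-* b d))) (⁻¹-involutive (b * d)))

-- Coordinate formulas over an arbitrary raw ring.
--
-- They are instantiated twice: in K, and in the solver's language of
-- integer polynomial expressions.  The first group copies, symbol for
-- symbol, the formulas of Defs.Geometry (only the expression instance of
-- these is used: evaluating it gives back the Defs formula
-- definitionally).

module Formulas (R : RawRing 0ℓ 0ℓ) where
  open RawRing R public using (Carrier; _+_; _*_; -_; 0#; 1#)

  infixl 6 _-_
  _-_ : Carrier → Carrier → Carrier
  x - y = x + - y

  Vec3 : Set
  Vec3 = Carrier × Carrier × Carrier

  Matrix : Set
  Matrix = Fin 3 → Fin 3 → Carrier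

  record Form : Set where
    constructor form
    field a b c f g h : Carrier
  open Form

  det3 : Vec3 → Vec3 → Vec3 → Carrier
  det3 (a₁ , a₂ , a₃) (b₁ , b₂ , b₃) (c₁ , c₂ , c₃) =
      a₁ * (b₂ * c₃ - b₃ * c₂)
    - a₂ * (b₁ * c₃ - b₃ * c₁)
    + a₃ * (b₁ * c₂ - b₂ * c₁)

  eval : Form → Vec3 → Carrier
  eval Q (x , y , z) =
    a Q * (x * x) + b Q * (y * y) + c Q * (z * z)
    + f Q * (y * z) + g Q * (x * z) + h Q * (x * y)

  four : Carrier
  four = 1# + 1# + 1# + 1#

  disc : Form → Carrier
  disc Q = four * a Q * b Q * c Q - a Q * (f Q * f Q) - b Q * (g Q * g Q)
           - c Q * (h Q * h Q) + f Q * g Q * h Q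

  matDet : Matrix → Carrier
  matDet M = det3 (M 0F 0F , M 0F 1F , M 0F 2F)
                  (M 1F 0F , M 1F 1F , M 1F 2F)
                  (M 2F 0F , M 2F 1F , M 2F 2F)

  mulV : Matrix → Vec3 → Vec3
  mulV M (x , y , z) =
    (M 0F 0F * x + M 0F 1F * y + M 0F 2F * z) ,
    (M 1F 0F * x + M 1F 1F * y + M 1F 2F * z) ,
    (M 2F 0F * x + M 2F 1F * y + M 2F 2F * z)

  pull : Form → Matrix → Form
  pull Q M = form (co 0F 0F) (co 1F 1F) (co 2F 2F) (co 1F 2F) (co 0F 2F) (co 0F 1F)
    where
    pc : Fin 3 → Fin 3 → Fin 3 → Fin 3 → Carrier
    pc i j k l with k Fin.≟ l
    ... | yes _ = M i k * M j k
    ... | no  _ = M i k * M j l + M i l * M j k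
    co : Fin 3 → Fin 3 → Carrier
    co k l = a Q * pc 0F 0F k l + b Q * pc 1F 1F k l + c Q * pc 2F 2F k l
           + f Q * pc 1F 2F k l + g Q * pc 0F 2F k l + h Q * pc 0F 1F k l

  0ᵛ : Vec3
  0ᵛ = 0# , 0# , 0#

  scale : Carrier → Vec3 → Vec3
  scale t (x , y , z) = t * x , t * y , t * z

  infixl 6 _-ᵛ_
  _-ᵛ_ : Vec3 → Vec3 → Vec3
  (x₁ , x₂ , x₃) -ᵛ (y₁ , y₂ , y₃) = x₁ - y₁ , x₂ - y₂ , x₃ - y₃

  dot : Vec3 → Vec3 → Carrier
  dot (x₁ , x₂ , x₃) (y₁ , y₂ , y₃) = x₁ * y₁ + x₂ * y₂ + x₃ * y₃

  cross : Vec3 → Vec3 → Vec3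
  cross (x₁ , x₂ , x₃) (y₁ , y₂ , y₃) = x₂ * y₃ - x₃ * y₂ , x₃ * y₁ - x₁ * y₃ , x₁ * y₂ - x₂ * y₁

  componentwise : Vec3 → Vec3 → Vec3
  componentwise (x₁ , x₂ , x₃) (y₁ , y₂ , y₃) = x₁ * y₁ , x₂ * y₂ , x₃ * y₃

  -- The monomials y z, x z, x y: a form without square terms is
  -- W ↦ dot (f , g , h) (pairProducts W).
  pairProducts : Vec3 → Vec3
  pairProducts (x , y , z) = y * z , x * z , x * y

  columns : Vec3 → Vec3 → Vec3 → Matrix
  columns (a₁ , a₂ , a₃) (b₁ , b₂ , b₃) (c₁ , c₂ , c₃) = entry
    where
    entry : Fin 3 → Fin 3 → Carrier
    entry 0F 0F = a₁
    entry 0F 1F = b₁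
    entry 0F 2F = c₁
    entry 1F 0F = a₂
    entry 1F 1F = b₂
    entry 1F 2F = c₂
    entry 2F 0F = a₃
    entry 2F 1F = b₃
    entry 2F 2F = c₃

  -- Coordinates of X with respect to the frame A, B, C, scaled by
  -- det3 A B C (Cramer's rule).
  coords : Vec3 → Vec3 → Vec3 → Vec3 → Vec3
  coords A B C X = det3 X B C , det3 A X C , det3 A B X

-- The ring solver for K, with integer coefficients.
--
-- Polynomial identities are checked by normalising both sides with
-- integer coefficients (a computation), and transported to K along the
-- ring homomorphism fromℤ : ℤ → K, which is constructed first.

module IntegerSolver {N : ℕ} (𝔽 : FiniteField N) where
  open FieldAlgebra 𝔽
  open import Algebra.Properties.Semiring.Mult.TCOptimised semiring
    using (1+×; ×-homo-+; ×1-homo-*) renaming (_×_ to _⨯_)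
  open ≡-Reasoning

  ℤ-rawRing : RawRing 0ℓ 0ℓ
  ℤ-rawRing = CommutativeRing.rawRing ℤP.+-*-commutativeRing

  fromℕ : ℕ → K
  fromℕ n = n ⨯ 1#

  fromℤ : ℤ → K
  fromℤ (⁺ n)     = fromℕ n
  fromℤ -[1+ n ]  = - fromℕ (suc n)

  fromℤ-⊖ : ∀ m n → fromℤ (m ⊖ n) ≡ fromℕ m - fromℕ n
  fromℤ-⊖ zero    zero    = sym (-‿inverseʳ 0#)
  fromℤ-⊖ zero    (suc n) = sym (+-identityˡ _)
  fromℤ-⊖ (suc m) zero    = sym (trans (cong (fromℕ (suc m) +_) ε⁻¹≈ε) (+-identityʳ _))
  fromℤ-⊖ (suc m) (suc n) = begin
    fromℤ (suc m ⊖ suc n)                       ≡⟨ cong fromℤ (ℤP.[1+m]⊖[1+n]≡m⊖n m n) ⟩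
    fromℤ (m ⊖ n)                               ≡⟨ fromℤ-⊖ m n ⟩
    fromℕ m - fromℕ n                           ≡⟨ sym (+-identityˡ _) ⟩
    0# + (fromℕ m - fromℕ n)                    ≡⟨ cong (_+ (fromℕ m - fromℕ n)) (sym (-‿inverseʳ 1#)) ⟩
    (1# - 1#) + (fromℕ m - fromℕ n)             ≡⟨ sym (+-sub-interchange 1# 1# (fromℕ m) (fromℕ n)) ⟩
    (1# + fromℕ m) - (1# + fromℕ n)             ≡⟨ sym (cong₂ _-_ (1+× m 1#) (1+× n 1#)) ⟩
    fromℕ (suc m) - fromℕ (suc n)               ∎

  -- Every integer is a difference of naturals; this reduces the
  -- homomorphism laws to those of fromℕ.
  private
    pos neg : ℤ → ℕ
    pos (⁺ n)    = n
    pos -[1+ n ] = 0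
    neg (⁺ n)    = 0
    neg -[1+ n ] = suc n

    as-difference : ∀ i → i ≡ ⁺ pos i ℤ.- ⁺ neg i
    as-difference (⁺ n)    = sym (ℤP.+-identityʳ (⁺ n))
    as-difference -[1+ n ] = refl

    fromℤ-difference : ∀ i → fromℤ i ≡ fromℕ (pos i) - fromℕ (neg i)
    fromℤ-difference i = trans (cong fromℤ (trans (as-difference i) (ℤP.[+m]-[+n]≡m⊖n (pos i) (neg i))))
                               (fromℤ-⊖ (pos i) (neg i))

    open import Data.Integer.Tactic.RingSolver using (solve-∀)

    ℤ-sum : ∀ (a b c d : ℤ) → (a ℤ.- b) ℤ.+ (c ℤ.- d) ≡ (a ℤ.+ c) ℤ.- (b ℤ.+ d)
    ℤ-sum = solve-∀
    ℤ-product : ∀ (a b c d : ℤ) → (a ℤ.- b) ℤ.* (c ℤ.- d) ≡ (a ℤ.* c ℤ.+ b ℤ.* d) ℤ.- (a ℤ.* d ℤ.+ b ℤ.* c)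
    ℤ-product = solve-∀

    ⁺-sumOfProducts : ∀ w x y z → ⁺ w ℤ.* ⁺ x ℤ.+ ⁺ y ℤ.* ⁺ z ≡ ⁺ (w ℕ.* x ℕ.+ y ℕ.* z)
    ⁺-sumOfProducts w x y z = sym (cong₂ ℤ._+_ (ℤP.pos-* w x) (ℤP.pos-* y z))

    fromℤ-naturalDifference : ∀ m n → fromℤ (⁺ m ℤ.- ⁺ n) ≡ fromℕ m - fromℕ n
    fromℤ-naturalDifference m n = trans (cong fromℤ (ℤP.[+m]-[+n]≡m⊖n m n)) (fromℤ-⊖ m n)

  fromℤ-+ : ∀ i j → fromℤ (i ℤ.+ j) ≡ fromℤ i + fromℤ j
  fromℤ-+ i j = begin
    fromℤ (i ℤ.+ j)                            ≡⟨ cong fromℤ (cong₂ ℤ._+_ (as-difference i) (as-difference j)) ⟩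
    fromℤ ((⁺ a ℤ.- ⁺ b) ℤ.+ (⁺ c ℤ.- ⁺ d))    ≡⟨ cong fromℤ (ℤ-sum (⁺ a) (⁺ b) (⁺ c) (⁺ d)) ⟩
    fromℤ (⁺ (a ℕ.+ c) ℤ.- ⁺ (b ℕ.+ d))        ≡⟨ fromℤ-naturalDifference (a ℕ.+ c) (b ℕ.+ d) ⟩
    fromℕ (a ℕ.+ c) - fromℕ (b ℕ.+ d)          ≡⟨ cong₂ _-_ (×-homo-+ 1# a c) (×-homo-+ 1# b d) ⟩
    (fromℕ a + fromℕ c) - (fromℕ b + fromℕ d)  ≡⟨ +-sub-interchange _ _ _ _ ⟩
    (fromℕ a - fromℕ b) + (fromℕ c - fromℕ d)  ≡⟨ sym (cong₂ _+_ (fromℤ-difference i) (fromℤ-difference j)) ⟩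
    fromℤ i + fromℤ j                          ∎
    where a = pos i; b = neg i; c = pos j; d = neg j

  fromℤ-* : ∀ i j → fromℤ (i ℤ.* j) ≡ fromℤ i * fromℤ j
  fromℤ-* i j = begin
    fromℤ (i ℤ.* j)                              ≡⟨ cong fromℤ (cong₂ ℤ._*_ (as-difference i) (as-difference j)) ⟩
    fromℤ ((⁺ a ℤ.- ⁺ b) ℤ.* (⁺ c ℤ.- ⁺ d))
      ≡⟨ cong fromℤ (trans (ℤ-product (⁺ a) (⁺ b) (⁺ c) (⁺ d))
                            (cong₂ ℤ._-_ (⁺-sumOfProducts a c b d) (⁺-sumOfProducts a d b c))) ⟩
    fromℤ (⁺ (a ℕ.* c ℕ.+ b ℕ.* d) ℤ.- ⁺ (a ℕ.* d ℕ.+ b ℕ.* c))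
      ≡⟨ fromℤ-naturalDifference (a ℕ.* c ℕ.+ b ℕ.* d) (a ℕ.* d ℕ.+ b ℕ.* c) ⟩
    fromℕ (a ℕ.* c ℕ.+ b ℕ.* d) - fromℕ (a ℕ.* d ℕ.+ b ℕ.* c)
      ≡⟨ cong₂ _-_ (homo₂ a c b d) (homo₂ a d b c) ⟩
    (fromℕ a * fromℕ c + fromℕ b * fromℕ d) - (fromℕ a * fromℕ d + fromℕ b * fromℕ c)
      ≡⟨ sym (*-sub-expand _ _ _ _) ⟩
    (fromℕ a - fromℕ b) * (fromℕ c - fromℕ d)    ≡⟨ sym (cong₂ _*_ (fromℤ-difference i) (fromℤ-difference j)) ⟩
    fromℤ i * fromℤ j                            ∎
    where
    a = pos i; b = neg i; c = pos j; d = neg j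
    homo₂ : ∀ w x y z → fromℕ (w ℕ.* x ℕ.+ y ℕ.* z) ≡ fromℕ w * fromℕ x + fromℕ y * fromℕ z
    homo₂ w x y z = trans (×-homo-+ 1# (w ℕ.* x) (y ℕ.* z)) (cong₂ _+_ (×1-homo-* w x) (×1-homo-* y z))

  fromℤ-neg : ∀ i → fromℤ (ℤ.- i) ≡ - fromℤ i
  fromℤ-neg i = inverseʳ-unique (fromℤ i) (fromℤ (ℤ.- i)) (begin
    fromℤ i + fromℤ (ℤ.- i)     ≡⟨ sym (fromℤ-+ i (ℤ.- i)) ⟩
    fromℤ (i ℤ.+ ℤ.- i)         ≡⟨ cong fromℤ (ℤP.+-inverseʳ i) ⟩
    0#                          ∎)

  ℤ⟶K : ℤ-rawRing -Raw-AlmostCommutative⟶ fromCommutativeRing commutativeRing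
  ℤ⟶K = record
    { ⟦_⟧ = fromℤ ; +-homo = fromℤ-+ ; *-homo = fromℤ-* ; -‿homo = fromℤ-neg ; 0-homo = refl ; 1-homo = refl }

  fromℤ-≟ : ∀ i j → Maybe (fromℤ i ≡ fromℤ j)
  fromℤ-≟ i j with i ℤ.≟ j
  ... | yes i≡j = just (cong fromℤ i≡j)
  ... | no  _   = nothing

  open import Algebra.Solver.Ring ℤ-rawRing (fromCommutativeRing commutativeRing) ℤ⟶K fromℤ-≟ public
    using (Polynomial; op; [+]; [*]; con; var; _:^_; :-_; ⟦_⟧; ⟦_⟧↓; correct; prove; solve; _:=_)
  open import Relation.Binary.Reflection (setoid K) var ⟦_⟧ ⟦_⟧↓ correct public using (close)

  expressions : ℕ → RawRing 0ℓ 0ℓ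
  expressions n = record
    { Carrier = Polynomial n ; _≈_ = _≡_ ; _+_ = op [+] ; _*_ = op [*] ; -_ = :-_ ; 0# = con (⁺ 0) ; 1# = con (⁺ 1) }

  module ℰ {n : ℕ} = Formulas (expressions n)

  matrix : ∀ {n} (m₀₀ m₀₁ m₀₂ m₁₀ m₁₁ m₁₂ m₂₀ m₂₁ m₂₂ : Polynomial n) → ℰ.Matrix
  matrix m₀₀ m₀₁ m₀₂ m₁₀ m₁₁ m₁₂ m₂₀ m₂₁ m₂₂ = ℰ.columns (m₀₀ , m₁₀ , m₂₀) (m₀₁ , m₁₁ , m₂₁) (m₀₂ , m₁₂ , m₂₂)

  π₁ π₂ π₃ : ∀ {A : Set} → A × A × A → A
  π₁ = proj₁
  π₂ v = proj₁ (proj₂ v)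
  π₃ v = proj₂ (proj₂ v)

-- Polynomial identities in K, each checked by the ring solver.
--
-- Each identity is stated with the formulas of Defs.Geometry; the solver
-- is run on their syntactic copies in ℰ, which evaluate back to them.

module Identities {N : ℕ} (𝔽 : FiniteField N) (q : ℕ) where
  open FieldAlgebra 𝔽
  open IntegerSolver 𝔽 using (Polynomial; :-_; ⟦_⟧; ⟦_⟧↓; prove; solve; _:=_; close; module ℰ; matrix; π₁; π₂; π₃)
  open Geometry 𝔽 q
  open Formulas (CommutativeRing.rawRing commutativeRing) public
    using (0ᵛ; scale; _-ᵛ_; dot; cross; componentwise; pairProducts; columns; coords)

  vec-≡ : ∀ {x₁ x₂ x₃ y₁ y₂ y₃ : K} → x₁ ≡ y₁ → x₂ ≡ y₂ → x₃ ≡ y₃ → (x₁ , x₂ , x₃) ≡ (y₁ , y₂ , y₃)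
  vec-≡ refl refl refl = refl

  form-≡ : ∀ {a₁ b₁ c₁ f₁ g₁ h₁ a₂ b₂ c₂ f₂ g₂ h₂} → a₁ ≡ a₂ → b₁ ≡ b₂ → c₁ ≡ c₂ → f₁ ≡ f₂ → g₁ ≡ g₂ → h₁ ≡ h₂ →
           form a₁ b₁ c₁ f₁ g₁ h₁ ≡ form a₂ b₂ c₂ f₂ g₂ h₂
  form-≡ refl refl refl refl refl refl = refl


  private
    -- The ring solver, applied componentwise to an identity between
    -- vectors: vec-solve n (λ x₁ … xₙ → lhs , rhs) (x₁ ∷ … ∷ xₙ ∷ []) refl refl refl.
    ⟦_⟧³ : ∀ {n} → ℰ.Vec3 {n} → Vec K n → K × K × K
    ⟦ v ⟧³ ρ = ⟦ π₁ v ⟧ ρ , ⟦ π₂ v ⟧ ρ , ⟦ π₃ v ⟧ ρ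

    vec-solve : ∀ n (eqn : N-ary n (Polynomial n) (ℰ.Vec3 {n} × ℰ.Vec3 {n})) (ρ : Vec K n) →
                let L = proj₁ (close n eqn) ; R = proj₂ (close n eqn) in
                ⟦ π₁ L ⟧↓ ρ ≡ ⟦ π₁ R ⟧↓ ρ → ⟦ π₂ L ⟧↓ ρ ≡ ⟦ π₂ R ⟧↓ ρ → ⟦ π₃ L ⟧↓ ρ ≡ ⟦ π₃ R ⟧↓ ρ →
                ⟦ L ⟧³ ρ ≡ ⟦ R ⟧³ ρ
    vec-solve n eqn ρ e₁ e₂ e₃ = vec-≡ (prove ρ (π₁ L) (π₁ R) e₁) (prove ρ (π₂ L) (π₂ R) e₂) (prove ρ (π₃ L) (π₃ R) e₃)
      where L = proj₁ (close n eqn) ; R = proj₂ (close n eqn)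

  eval-pull : ∀ Q M X → eval (pull Q M) X ≡ eval Q (mulV M X)
  eval-pull Q M (x , y , z) =
    solve 18 (λ qa qb qc qf qg qh m₀₀ m₀₁ m₀₂ m₁₀ m₁₁ m₁₂ m₂₀ m₂₁ m₂₂ x y z →
                let Qᴱ = ℰ.form qa qb qc qf qg qh ; Mᴱ = matrix m₀₀ m₀₁ m₀₂ m₁₀ m₁₁ m₁₂ m₂₀ m₂₁ m₂₂ in
                ℰ.eval (ℰ.pull Qᴱ Mᴱ) (x , y , z) := ℰ.eval Qᴱ (ℰ.mulV Mᴱ (x , y , z)))
          refl (a Q) (b Q) (c Q) (f Q) (g Q) (h Q)
               (M 0F 0F) (M 0F 1F) (M 0F 2F) (M 1F 0F) (M 1F 1F) (M 1F 2F) (M 2F 0F) (M 2F 1F) (M 2F 2F) x y z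

  disc-pull : ∀ Q M → disc (pull Q M) ≡ (matDet M * matDet M) * disc Q
  disc-pull Q M =
    solve 15 (λ qa qb qc qf qg qh m₀₀ m₀₁ m₀₂ m₁₀ m₁₁ m₁₂ m₂₀ m₂₁ m₂₂ →
                let Qᴱ = ℰ.form qa qb qc qf qg qh ; Mᴱ = matrix m₀₀ m₀₁ m₀₂ m₁₀ m₁₁ m₁₂ m₂₀ m₂₁ m₂₂ in
                ℰ.disc (ℰ.pull Qᴱ Mᴱ) := (ℰ.matDet Mᴱ ℰ.* ℰ.matDet Mᴱ) ℰ.* ℰ.disc Qᴱ)
          refl (a Q) (b Q) (c Q) (f Q) (g Q) (h Q)
               (M 0F 0F) (M 0F 1F) (M 0F 2F) (M 1F 0F) (M 1F 1F) (M 1F 2F) (M 2F 0F) (M 2F 1F) (M 2F 2F)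

  det-mulV : ∀ M X Y Z → det3 (mulV M X) (mulV M Y) (mulV M Z) ≡ matDet M * det3 X Y Z
  det-mulV M (x₁ , x₂ , x₃) (y₁ , y₂ , y₃) (z₁ , z₂ , z₃) =
    solve 18 (λ m₀₀ m₀₁ m₀₂ m₁₀ m₁₁ m₁₂ m₂₀ m₂₁ m₂₂ x₁ x₂ x₃ y₁ y₂ y₃ z₁ z₂ z₃ →
                let Mᴱ = matrix m₀₀ m₀₁ m₀₂ m₁₀ m₁₁ m₁₂ m₂₀ m₂₁ m₂₂
                    X = x₁ , x₂ , x₃ ; Y = y₁ , y₂ , y₃ ; Z = z₁ , z₂ , z₃ in
                ℰ.det3 (ℰ.mulV Mᴱ X) (ℰ.mulV Mᴱ Y) (ℰ.mulV Mᴱ Z) := ℰ.matDet Mᴱ ℰ.* ℰ.det3 X Y Z)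
          refl (M 0F 0F) (M 0F 1F) (M 0F 2F) (M 1F 0F) (M 1F 1F) (M 1F 2F) (M 2F 0F) (M 2F 1F) (M 2F 2F)
               x₁ x₂ x₃ y₁ y₂ y₃ z₁ z₂ z₃

  -- The determinant of a matrix equals that of its transpose.
  matDet-columns : ∀ A B C → matDet (columns A B C) ≡ det3 A B C
  matDet-columns (a₁ , a₂ , a₃) (b₁ , b₂ , b₃) (c₁ , c₂ , c₃) =
    solve 9 (λ a₁ a₂ a₃ b₁ b₂ b₃ c₁ c₂ c₃ →
               let A = a₁ , a₂ , a₃ ; B = b₁ , b₂ , b₃ ; C = c₁ , c₂ , c₃ in
               ℰ.matDet (ℰ.columns A B C) := ℰ.det3 A B C)
          refl a₁ a₂ a₃ b₁ b₂ b₃ c₁ c₂ c₃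

  eval-scale : ∀ Q t X → eval Q (scale t X) ≡ (t * t) * eval Q X
  eval-scale Q t (x , y , z) =
    solve 10 (λ qa qb qc qf qg qh t x y z →
                let Qᴱ = ℰ.form qa qb qc qf qg qh in
                ℰ.eval Qᴱ (ℰ.scale t (x , y , z)) := (t ℰ.* t) ℰ.* ℰ.eval Qᴱ (x , y , z))
          refl (a Q) (b Q) (c Q) (f Q) (g Q) (h Q) t x y z

  eval-noSquares : ∀ f′ g′ h′ W → eval (form 0# 0# 0# f′ g′ h′) W ≡ dot (f′ , g′ , h′) (pairProducts W)
  eval-noSquares f′ g′ h′ (x , y , z) =
    solve 6 (λ f g h x y z → ℰ.eval (ℰ.form ℰ.0# ℰ.0# ℰ.0# f g h) (x , y , z) := ℰ.dot (f , g , h) (ℰ.pairProducts (x , y , z)))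
          refl f′ g′ h′ x y z

  disc-noSquares : ∀ f′ g′ h′ → disc (form 0# 0# 0# f′ g′ h′) ≡ f′ * g′ * h′
  disc-noSquares = solve 3 (λ f g h → ℰ.disc (ℰ.form ℰ.0# ℰ.0# ℰ.0# f g h) := f ℰ.* g ℰ.* h) refl

  dot-pairProducts₁ : ∀ F β γ → dot F (pairProducts (0# , β , γ)) ≡ proj₁ F * (β * γ)
  dot-pairProducts₁ (f′ , g′ , h′) β γ =
    solve 5 (λ f g h β γ → ℰ.dot (f , g , h) (ℰ.pairProducts (ℰ.0# , β , γ)) := f ℰ.* (β ℰ.* γ)) refl f′ g′ h′ β γ

  dot-pairProducts₂ : ∀ F α γ → dot F (pairProducts (α , 0# , γ)) ≡ proj₁ (proj₂ F) * (α * γ)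
  dot-pairProducts₂ (f′ , g′ , h′) α γ =
    solve 5 (λ f g h α γ → ℰ.dot (f , g , h) (ℰ.pairProducts (α , ℰ.0# , γ)) := g ℰ.* (α ℰ.* γ)) refl f′ g′ h′ α γ

  dot-pairProducts₃ : ∀ F α β → dot F (pairProducts (α , β , 0#)) ≡ proj₂ (proj₂ F) * (α * β)
  dot-pairProducts₃ (f′ , g′ , h′) α β =
    solve 5 (λ f g h α β → ℰ.dot (f , g , h) (ℰ.pairProducts (α , β , ℰ.0#)) := h ℰ.* (α ℰ.* β)) refl f′ g′ h′ α β

  dot-scale : ∀ t F U → dot (scale t F) U ≡ t * dot F U
  dot-scale t (f₁ , f₂ , f₃) (u₁ , u₂ , u₃) =
    solve 7 (λ t f₁ f₂ f₃ u₁ u₂ u₃ → ℰ.dot (ℰ.scale t (f₁ , f₂ , f₃)) (u₁ , u₂ , u₃) := t ℰ.* ℰ.dot (f₁ , f₂ , f₃) (u₁ , u₂ , u₃))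
          refl t f₁ f₂ f₃ u₁ u₂ u₃

  det-tripleProduct : ∀ X Y Z → det3 X Y Z ≡ dot (cross X Y) Z
  det-tripleProduct (x₁ , x₂ , x₃) (y₁ , y₂ , y₃) (z₁ , z₂ , z₃) =
    solve 9 (λ x₁ x₂ x₃ y₁ y₂ y₃ z₁ z₂ z₃ →
               let X = x₁ , x₂ , x₃ ; Y = y₁ , y₂ , y₃ ; Z = z₁ , z₂ , z₃ in
               ℰ.det3 X Y Z := ℰ.dot (ℰ.cross X Y) Z)
          refl x₁ x₂ x₃ y₁ y₂ y₃ z₁ z₂ z₃

  det-0ᵛ₁ : ∀ Y Z → det3 0ᵛ Y Z ≡ 0#
  det-0ᵛ₁ (y₁ , y₂ , y₃) (z₁ , z₂ , z₃) =
    solve 6 (λ y₁ y₂ y₃ z₁ z₂ z₃ → ℰ.det3 ℰ.0ᵛ (y₁ , y₂ , y₃) (z₁ , z₂ , z₃) := ℰ.0#) refl y₁ y₂ y₃ z₁ z₂ z₃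

  det-0ᵛ₂ : ∀ X Z → det3 X 0ᵛ Z ≡ 0#
  det-0ᵛ₂ (x₁ , x₂ , x₃) (z₁ , z₂ , z₃) =
    solve 6 (λ x₁ x₂ x₃ z₁ z₂ z₃ → ℰ.det3 (x₁ , x₂ , x₃) ℰ.0ᵛ (z₁ , z₂ , z₃) := ℰ.0#) refl x₁ x₂ x₃ z₁ z₂ z₃

  det-0ᵛ₃ : ∀ X Y → det3 X Y 0ᵛ ≡ 0#
  det-0ᵛ₃ (x₁ , x₂ , x₃) (y₁ , y₂ , y₃) =
    solve 6 (λ x₁ x₂ x₃ y₁ y₂ y₃ → ℰ.det3 (x₁ , x₂ , x₃) (y₁ , y₂ , y₃) ℰ.0ᵛ := ℰ.0#) refl x₁ x₂ x₃ y₁ y₂ y₃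

  -- A form is determined by its values: its coefficients are recovered by
  -- evaluating at the points e₁, e₂, e₃, e₂ + e₃, e₁ + e₃, e₁ + e₂.
  coefficient-a : ∀ Q → a Q ≡ eval Q (1# , 0# , 0#)
  coefficient-a Q = solve 6 (λ qa qb qc qf qg qh → qa := ℰ.eval (ℰ.form qa qb qc qf qg qh) (ℰ.1# , ℰ.0# , ℰ.0#))
                          refl (a Q) (b Q) (c Q) (f Q) (g Q) (h Q)

  coefficient-b : ∀ Q → b Q ≡ eval Q (0# , 1# , 0#)
  coefficient-b Q = solve 6 (λ qa qb qc qf qg qh → qb := ℰ.eval (ℰ.form qa qb qc qf qg qh) (ℰ.0# , ℰ.1# , ℰ.0#))
                          refl (a Q) (b Q) (c Q) (f Q) (g Q) (h Q)

  coefficient-c : ∀ Q → c Q ≡ eval Q (0# , 0# , 1#)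
  coefficient-c Q = solve 6 (λ qa qb qc qf qg qh → qc := ℰ.eval (ℰ.form qa qb qc qf qg qh) (ℰ.0# , ℰ.0# , ℰ.1#))
                          refl (a Q) (b Q) (c Q) (f Q) (g Q) (h Q)

  coefficient-f : ∀ Q → f Q ≡ eval Q (0# , 1# , 1#) - eval Q (0# , 1# , 0#) - eval Q (0# , 0# , 1#)
  coefficient-f Q =
    solve 6 (λ qa qb qc qf qg qh → let Qᴱ = ℰ.form qa qb qc qf qg qh in
               qf := ℰ.eval Qᴱ (ℰ.0# , ℰ.1# , ℰ.1#) ℰ.- ℰ.eval Qᴱ (ℰ.0# , ℰ.1# , ℰ.0#) ℰ.- ℰ.eval Qᴱ (ℰ.0# , ℰ.0# , ℰ.1#))
          refl (a Q) (b Q) (c Q) (f Q) (g Q) (h Q)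

  coefficient-g : ∀ Q → g Q ≡ eval Q (1# , 0# , 1#) - eval Q (1# , 0# , 0#) - eval Q (0# , 0# , 1#)
  coefficient-g Q =
    solve 6 (λ qa qb qc qf qg qh → let Qᴱ = ℰ.form qa qb qc qf qg qh in
               qg := ℰ.eval Qᴱ (ℰ.1# , ℰ.0# , ℰ.1#) ℰ.- ℰ.eval Qᴱ (ℰ.1# , ℰ.0# , ℰ.0#) ℰ.- ℰ.eval Qᴱ (ℰ.0# , ℰ.0# , ℰ.1#))
          refl (a Q) (b Q) (c Q) (f Q) (g Q) (h Q)

  coefficient-h : ∀ Q → h Q ≡ eval Q (1# , 1# , 0#) - eval Q (1# , 0# , 0#) - eval Q (0# , 1# , 0#)
  coefficient-h Q =
    solve 6 (λ qa qb qc qf qg qh → let Qᴱ = ℰ.form qa qb qc qf qg qh in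
               qh := ℰ.eval Qᴱ (ℰ.1# , ℰ.1# , ℰ.0#) ℰ.- ℰ.eval Qᴱ (ℰ.1# , ℰ.0# , ℰ.0#) ℰ.- ℰ.eval Qᴱ (ℰ.0# , ℰ.1# , ℰ.0#))
          refl (a Q) (b Q) (c Q) (f Q) (g Q) (h Q)

  cramer : ∀ A B C X → mulV (columns A B C) (coords A B C X) ≡ scale (det3 A B C) X
  cramer (a₁ , a₂ , a₃) (b₁ , b₂ , b₃) (c₁ , c₂ , c₃) (x₁ , x₂ , x₃) =
    vec-solve 12 (λ a₁ a₂ a₃ b₁ b₂ b₃ c₁ c₂ c₃ x₁ x₂ x₃ →
                    let A = a₁ , a₂ , a₃ ; B = b₁ , b₂ , b₃ ; C = c₁ , c₂ , c₃ ; X = x₁ , x₂ , x₃ in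
                    ℰ.mulV (ℰ.columns A B C) (ℰ.coords A B C X) , ℰ.scale (ℰ.det3 A B C) X)
      (a₁ ∷ a₂ ∷ a₃ ∷ b₁ ∷ b₂ ∷ b₃ ∷ c₁ ∷ c₂ ∷ c₃ ∷ x₁ ∷ x₂ ∷ x₃ ∷ []) refl refl refl

  cross-scale : ∀ s t X Y → cross (scale s X) (scale t Y) ≡ scale (s * t) (cross X Y)
  cross-scale s t (x₁ , x₂ , x₃) (y₁ , y₂ , y₃) =
    vec-solve 8 (λ s t x₁ x₂ x₃ y₁ y₂ y₃ → let X = x₁ , x₂ , x₃ ; Y = y₁ , y₂ , y₃ in
                   ℰ.cross (ℰ.scale s X) (ℰ.scale t Y) , ℰ.scale (s ℰ.* t) (ℰ.cross X Y))
      (s ∷ t ∷ x₁ ∷ x₂ ∷ x₃ ∷ y₁ ∷ y₂ ∷ y₃ ∷ []) refl refl refl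

  cross-self : ∀ X → cross X X ≡ 0ᵛ
  cross-self (x₁ , x₂ , x₃) =
    vec-solve 3 (λ x₁ x₂ x₃ → ℰ.cross (x₁ , x₂ , x₃) (x₁ , x₂ , x₃) , ℰ.0ᵛ) (x₁ ∷ x₂ ∷ x₃ ∷ []) refl refl refl

  cross-antisym : ∀ X Y → cross Y X ≡ scale (- 1#) (cross X Y)
  cross-antisym (x₁ , x₂ , x₃) (y₁ , y₂ , y₃) =
    vec-solve 6 (λ x₁ x₂ x₃ y₁ y₂ y₃ → let X = x₁ , x₂ , x₃ ; Y = y₁ , y₂ , y₃ in
                   ℰ.cross Y X , ℰ.scale (:- ℰ.1#) (ℰ.cross X Y))
      (x₁ ∷ x₂ ∷ x₃ ∷ y₁ ∷ y₂ ∷ y₃ ∷ []) refl refl refl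

  cross-pairProducts : ∀ X Y → cross (pairProducts X) (pairProducts Y) ≡ componentwise (componentwise X Y) (cross Y X)
  cross-pairProducts (x₁ , x₂ , x₃) (y₁ , y₂ , y₃) =
    vec-solve 6 (λ x₁ x₂ x₃ y₁ y₂ y₃ → let X = x₁ , x₂ , x₃ ; Y = y₁ , y₂ , y₃ in
                   ℰ.cross (ℰ.pairProducts X) (ℰ.pairProducts Y) , ℰ.componentwise (ℰ.componentwise X Y) (ℰ.cross Y X))
      (x₁ ∷ x₂ ∷ x₃ ∷ y₁ ∷ y₂ ∷ y₃ ∷ []) refl refl refl

  cross-cross : ∀ U F G → cross U (cross F G) ≡ scale (dot G U) F -ᵛ scale (dot F U) G
  cross-cross (u₁ , u₂ , u₃) (f₁ , f₂ , f₃) (g₁ , g₂ , g₃) =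
    vec-solve 9 (λ u₁ u₂ u₃ f₁ f₂ f₃ g₁ g₂ g₃ → let U = u₁ , u₂ , u₃ ; F = f₁ , f₂ , f₃ ; G = g₁ , g₂ , g₃ in
                   ℰ.cross U (ℰ.cross F G) , ℰ.scale (ℰ.dot G U) F ℰ.-ᵛ ℰ.scale (ℰ.dot F U) G)
      (u₁ ∷ u₂ ∷ u₃ ∷ f₁ ∷ f₂ ∷ f₃ ∷ g₁ ∷ g₂ ∷ g₃ ∷ []) refl refl refl

  mulV-scale : ∀ M t X → mulV M (scale t X) ≡ scale t (mulV M X)
  mulV-scale M t (x₁ , x₂ , x₃) =
    vec-solve 13 (λ m₀₀ m₀₁ m₀₂ m₁₀ m₁₁ m₁₂ m₂₀ m₂₁ m₂₂ t x₁ x₂ x₃ →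
                    let Mᴱ = matrix m₀₀ m₀₁ m₀₂ m₁₀ m₁₁ m₁₂ m₂₀ m₂₁ m₂₂ ; X = x₁ , x₂ , x₃ in
                    ℰ.mulV Mᴱ (ℰ.scale t X) , ℰ.scale t (ℰ.mulV Mᴱ X))
      (M 0F 0F ∷ M 0F 1F ∷ M 0F 2F ∷ M 1F 0F ∷ M 1F 1F ∷ M 1F 2F ∷ M 2F 0F ∷ M 2F 1F ∷ M 2F 2F ∷ t ∷ x₁ ∷ x₂ ∷ x₃ ∷ [])
      refl refl refl

  columns-first : ∀ A B C α → mulV (columns A B C) (α , 0# , 0#) ≡ scale α A
  columns-first (a₁ , a₂ , a₃) (b₁ , b₂ , b₃) (c₁ , c₂ , c₃) α =
    vec-solve 10 (λ a₁ a₂ a₃ b₁ b₂ b₃ c₁ c₂ c₃ α → let A = a₁ , a₂ , a₃ ; B = b₁ , b₂ , b₃ ; C = c₁ , c₂ , c₃ in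
                    ℰ.mulV (ℰ.columns A B C) (α , ℰ.0# , ℰ.0#) , ℰ.scale α A)
      (a₁ ∷ a₂ ∷ a₃ ∷ b₁ ∷ b₂ ∷ b₃ ∷ c₁ ∷ c₂ ∷ c₃ ∷ α ∷ []) refl refl refl

  columns-second : ∀ A B C β → mulV (columns A B C) (0# , β , 0#) ≡ scale β B
  columns-second (a₁ , a₂ , a₃) (b₁ , b₂ , b₃) (c₁ , c₂ , c₃) β =
    vec-solve 10 (λ a₁ a₂ a₃ b₁ b₂ b₃ c₁ c₂ c₃ β → let A = a₁ , a₂ , a₃ ; B = b₁ , b₂ , b₃ ; C = c₁ , c₂ , c₃ in
                    ℰ.mulV (ℰ.columns A B C) (ℰ.0# , β , ℰ.0#) , ℰ.scale β B)
      (a₁ ∷ a₂ ∷ a₃ ∷ b₁ ∷ b₂ ∷ b₃ ∷ c₁ ∷ c₂ ∷ c₃ ∷ β ∷ []) refl refl refl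

  columns-third : ∀ A B C γ → mulV (columns A B C) (0# , 0# , γ) ≡ scale γ C
  columns-third (a₁ , a₂ , a₃) (b₁ , b₂ , b₃) (c₁ , c₂ , c₃) γ =
    vec-solve 10 (λ a₁ a₂ a₃ b₁ b₂ b₃ c₁ c₂ c₃ γ → let A = a₁ , a₂ , a₃ ; B = b₁ , b₂ , b₃ ; C = c₁ , c₂ , c₃ in
                    ℰ.mulV (ℰ.columns A B C) (ℰ.0# , ℰ.0# , γ) , ℰ.scale γ C)
      (a₁ ∷ a₂ ∷ a₃ ∷ b₁ ∷ b₂ ∷ b₃ ∷ c₁ ∷ c₂ ∷ c₃ ∷ γ ∷ []) refl refl refl

-- Counting in the finite field: N · 1 = 0 and x ^ N = x.
--
-- Both are Lagrange-type arguments: a sum (resp. product) over all of K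
-- does not change when the elements are translated by 1 (resp. multiplied
-- by a unit), since this permutes K.

module Counting {N : ℕ} (𝔽 : FiniteField N) where
  open FieldAlgebra 𝔽
  open IntegerSolver 𝔽 using (fromℕ)
  open ≡-Reasoning

  element : Fin N → K
  element = Bijection.to⁻ card

  index : K → Fin N
  index = Bijection.to card

  index-element : ∀ i → index (element i) ≡ i
  index-element i = proj₂ (Bijection.strictlySurjective card i)

  element-index : ∀ x → element (index x) ≡ x
  element-index x = Bijection.injective card (index-element (index x))

  sum-bijection : (C : CommutativeMonoid 0ℓ 0ℓ) (let open CommutativeMonoid C using (Carrier; _≈_)) →
                  ∀ (g : K → Carrier) (φ ψ : K → K) → (∀ x → φ (ψ x) ≡ x) → (∀ x → ψ (φ x) ≡ x) →
                  Sum.sum C (λ i → g (element i)) ≈ Sum.sum C (λ i → g (φ (element i)))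
  sum-bijection C g φ ψ φψ ψφ =
    CommutativeMonoid.trans C (Sum.sum-permute C (λ i → g (element i)) π)
      (CommutativeMonoid.reflexive C (Sum.sum-cong-≗ C (λ i → cong g (element-index (φ (element i))))))
    where
    conjugate : (K → K) → Fin N → Fin N
    conjugate θ i = index (θ (element i))

    inverse-law : ∀ θ θ′ → (∀ x → θ (θ′ x) ≡ x) → ∀ i → conjugate θ (conjugate θ′ i) ≡ i
    inverse-law θ θ′ θθ′ i = begin
      index (θ (element (index (θ′ (element i))))) ≡⟨ cong (λ y → index (θ y)) (element-index _) ⟩
      index (θ (θ′ (element i)))                   ≡⟨ cong index (θθ′ (element i)) ⟩
      index (element i)                            ≡⟨ index-element i ⟩
      i                                            ∎

    π : Permutation′ N
    π = permutation (conjugate φ) (conjugate ψ) (inverse-law φ ψ φψ) (inverse-law ψ φ ψφ)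

  -- N · 1 = 0: translating every element of K by 1 does not change ∑ K.
  fromℕ-order : fromℕ N ≡ 0#
  fromℕ-order = trans (sym (×ᵤ≈× N 1#)) (identityˡ-unique (N ×ᵤ 1#) total N·1+total≡total)
    where
    open import Algebra.Properties.Semiring.Mult.TCOptimised semiring using (×ᵤ≈×)
    open import Algebra.Properties.CommutativeMonoid.Sum +-commutativeMonoid
      using (sum; ∑-distrib-+; sum-replicate)
    open import Algebra.Definitions.RawMonoid (CommutativeMonoid.rawMonoid +-commutativeMonoid)
      using () renaming (_×_ to _×ᵤ_)

    total = sum element

    cancel₁ : ∀ x → 1# + (- 1# + x) ≡ x
    cancel₁ x = trans (sym (+-assoc 1# (- 1#) x)) (trans (cong (_+ x) (-‿inverseʳ 1#)) (+-identityˡ x))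
    cancel₂ : ∀ x → - 1# + (1# + x) ≡ x
    cancel₂ x = trans (sym (+-assoc (- 1#) 1# x)) (trans (cong (_+ x) (-‿inverseˡ 1#)) (+-identityˡ x))

    N·1+total≡total : N ×ᵤ 1# + total ≡ total
    N·1+total≡total = begin
      N ×ᵤ 1# + total                  ≡⟨ cong (_+ total) (sym (sum-replicate N)) ⟩
      sum {N} (λ _ → 1#) + total       ≡⟨ sym (∑-distrib-+ {N} (λ _ → 1#) element) ⟩
      sum (λ i → 1# + element i)       ≡⟨ sym (sum-bijection +-commutativeMonoid id (1# +_) (- 1# +_) cancel₁ cancel₂) ⟩
      total                            ∎

  private
    module Product = Sum *-commutativeMonoid

  ∏ : ∀ {n} → (Fin n → K) → K
  ∏ = Product.sum

  ∏-nonzero : ∀ {n} (t : Fin n → K) → (∀ i → t i ≢ 0#) → ∏ t ≢ 0#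
  ∏-nonzero {zero}  t t≢0 1≡0 = 0≢1 (sym 1≡0)
  ∏-nonzero {suc n} t t≢0 = *-nonzero (t≢0 Fin.zero) (∏-nonzero (λ i → t (Fin.suc i)) (λ i → t≢0 (Fin.suc i)))

  ∏-allBut : ∀ {n} (t : Fin n → K) (i₀ : Fin n) (y : K) → t i₀ ≡ 1# → (∀ j → j ≢ i₀ → t j ≡ y) →
             Σ ℕ λ m → (n ≡ suc m) × (∏ t ≡ y ^ m)
  ∏-allBut {suc m} t i₀ y tᵢ₀≡1 t≡y = m , refl , (begin
    ∏ t                                ≡⟨ Product.sum-remove {i = i₀} t ⟩
    t i₀ * ∏ (λ j → t (Fin.punchIn i₀ j)) ≡⟨ cong₂ _*_ tᵢ₀≡1 (Product.sum-cong-≗ (λ j → t≡y _ (FinP.punchInᵢ≢i i₀ j))) ⟩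
    1# * ∏ {m} (λ _ → y)               ≡⟨ *-identityˡ _ ⟩
    ∏ {m} (λ _ → y)                    ≡⟨ Product.sum-replicate m ⟩
    y ^ₛ m                             ≡⟨ sym (^-agrees y m) ⟩
    y ^ m                              ∎)

  unitPart : K → K
  unitPart y with y ≟ 0#
  ... | yes _ = 1#
  ... | no  _ = y

  unitPart-nonzero : ∀ y → unitPart y ≢ 0#
  unitPart-nonzero y with y ≟ 0#
  ... | yes _   = λ 1≡0 → 0≢1 (sym 1≡0)
  ... | no  y≢0 = y≢0

  -- x ^ N = x for x ≢ 0: multiplication by x permutes K, so ∏ unitPart
  -- over K is unchanged by it; this gives ∏ multiplier = 1, a product
  -- which equals x ^ (N - 1).
  module UnitPower (x : K) (x≢0 : x ≢ 0#) where
    x⁻¹ : K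
    x⁻¹ = proj₁ (inverse x x≢0)

    x*x⁻¹ : x * x⁻¹ ≡ 1#
    x*x⁻¹ = proj₂ (inverse x x≢0)

    -- The factor by which unitPart changes when y is multiplied by x.
    multiplier : K → K
    multiplier y with y ≟ 0#
    ... | yes _ = 1#
    ... | no  _ = x

    multiplier-0 : multiplier 0# ≡ 1#
    multiplier-0 with 0# ≟ 0#
    ... | yes _   = refl
    ... | no  0≢0 = ⊥-elim (0≢0 refl)

    multiplier-nonzero : ∀ {y} → y ≢ 0# → multiplier y ≡ x
    multiplier-nonzero {y} y≢0 with y ≟ 0#
    ... | yes y≡0 = ⊥-elim (y≢0 y≡0)
    ... | no  _   = refl

    unitPart-* : ∀ y → unitPart (x * y) ≡ multiplier y * unitPart y
    unitPart-* y with y ≟ 0# | (x * y) ≟ 0#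
    ... | yes _   | yes _    = sym (*-identityˡ 1#)
    ... | yes y≡0 | no xy≢0  = ⊥-elim (xy≢0 (trans (cong (x *_) y≡0) (zeroʳ x)))
    ... | no  y≢0 | yes xy≡0 = ⊥-elim (*-nonzero x≢0 y≢0 xy≡0)
    ... | no  _   | no  _    = refl

    ∏-multiplier : ∏ (λ i → multiplier (element i)) ≡ 1#
    ∏-multiplier = *-cancelˡ {t = U} (∏-nonzero _ (λ i → unitPart-nonzero (element i))) (begin
      U * ∏ (λ i → multiplier (element i))  ≡⟨ *-comm U _ ⟩
      ∏ (λ i → multiplier (element i)) * U  ≡⟨ sym (Product.∑-distrib-+ (λ i → multiplier (element i)) (λ i → unitPart (element i))) ⟩
      ∏ (λ i → multiplier (element i) * unitPart (element i))
                                             ≡⟨ sym (Product.sum-cong-≗ (λ i → unitPart-* (element i))) ⟩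
      ∏ (λ i → unitPart (x * element i))     ≡⟨ sym (sum-bijection *-commutativeMonoid unitPart (x *_) (x⁻¹ *_) cancel₁ cancel₂) ⟩
      U                                      ≡⟨ sym (*-identityʳ U) ⟩
      U * 1#                                 ∎)
      where
      U = ∏ (λ i → unitPart (element i))
      cancel : ∀ u v → u * v ≡ 1# → ∀ y → u * (v * y) ≡ y
      cancel u v uv≡1 y = trans (sym (*-assoc u v y)) (trans (cong (_* y) uv≡1) (*-identityˡ y))
      cancel₁ = cancel x x⁻¹ x*x⁻¹
      cancel₂ = cancel x⁻¹ x (trans (*-comm x⁻¹ x) x*x⁻¹)

    -- All factors of ∏ multiplier but the one at 0 equal x, so x ^ (N - 1) = 1.
    pow-order : x ^ N ≡ x
    pow-order with ∏-allBut (λ i → multiplier (element i)) (index 0#) x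
                     (trans (cong multiplier (element-index 0#)) multiplier-0)
                     (λ j j≢i₀ → multiplier-nonzero (λ eⱼ≡0 → j≢i₀ (trans (sym (index-element j)) (cong index eⱼ≡0))))
    ... | m , refl , ∏≡xᵐ = begin
      x * x ^ m    ≡⟨ cong (x *_) (trans (sym ∏≡xᵐ) ∏-multiplier) ⟩
      x * 1#       ≡⟨ *-identityʳ x ⟩
      x            ∎

  pow-order : ∀ x → x ^ N ≡ x
  pow-order x with x ≟ 0#
  ... | no  x≢0  = UnitPower.pow-order x x≢0
  ... | yes refl = zero-power N (index 0#)
    where
    zero-power : ∀ n → Fin n → 0# ^ n ≡ 0#
    zero-power (suc n) _ = zeroˡ (0# ^ n)

-- A prime p divides the binomial coefficients p C k with 0 < k < p.

module PrimeBinomial (p : ℕ) (pr : Prime p) where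
  open import Data.Nat.Divisibility using (_∣_; ∣⇒≤; m∣m*n; ∣1⇒≡1)
  open import Data.Nat.Combinatorics using (_C_; nCk≡n!/k![n-k]!; k![n∸k]!∣n!)
  open import Data.Nat.DivMod using (m*[n/m]≡n)

  private instance
    p≢0 : ℕ.NonZero p
    p≢0 = prime⇒nonZero pr

  1<p : 1 ℕ.< p
  1<p = ℕ.nonTrivial⇒n>1 p {{prime⇒nonTrivial pr}}

  ∤-factorial : ∀ m → m ℕ.< p → ¬ (p ∣ m ℕ.!)
  ∤-factorial zero    _   p∣1 = ℕP.<⇒≢ 1<p (sym (∣1⇒≡1 p∣1))
  ∤-factorial (suc m) m<p p∣m! with euclidsLemma (suc m) (m ℕ.!) pr p∣m!
  ... | inj₁ p∣1+m = ℕP.<⇒≱ m<p (∣⇒≤ p∣1+m)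
  ... | inj₂ p∣m!  = ∤-factorial m (ℕP.<-trans (ℕP.n<1+n m) m<p) p∣m!

  p∣factorials : ∀ k → k ℕ.≤ p → p ∣ k ℕ.! ℕ.* (p ∸ k) ℕ.! ℕ.* (p C k)
  p∣factorials k k≤p = subst (p ∣_) (sym p!-split) (n∣n! p)
    where
    instance
      k![p-k]!≢0 : ℕ.NonZero (k ℕ.! ℕ.* (p ∸ k) ℕ.!)
      k![p-k]!≢0 = ℕP.m*n≢0 (k ℕ.!) ((p ∸ k) ℕ.!) {{ℕP._!≢0 k}} {{ℕP._!≢0 (p ∸ k)}}
    p!-split : k ℕ.! ℕ.* (p ∸ k) ℕ.! ℕ.* (p C k) ≡ p ℕ.!
    p!-split = trans (cong (k ℕ.! ℕ.* (p ∸ k) ℕ.! ℕ.*_) (nCk≡n!/k![n-k]! k≤p)) (m*[n/m]≡n (k![n∸k]!∣n! k≤p))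
    n∣n! : ∀ m → .{{ℕ.NonZero m}} → m ∣ m ℕ.!
    n∣n! (suc m) = m∣m*n (m ℕ.!)

  -- By Euclid's lemma p divides one of the factors, and only p C k is possible.
  p∣pCk : ∀ k → 0 ℕ.< k → k ℕ.< p → p ∣ p C k
  p∣pCk k 0<k k<p with euclidsLemma (k ℕ.! ℕ.* (p ∸ k) ℕ.!) (p C k) pr (p∣factorials k (ℕP.<⇒≤ k<p))
  ... | inj₂ p∣pCk = p∣pCk
  ... | inj₁ p∣k![p-k]! with euclidsLemma (k ℕ.!) ((p ∸ k) ℕ.!) pr p∣k![p-k]!
  ...   | inj₁ p∣k!     = ⊥-elim (∤-factorial k k<p p∣k!)
  ...   | inj₂ p∣[p-k]! = ⊥-elim (∤-factorial (p ∸ k) (ℕP.∸-monoʳ-< 0<k (ℕP.<⇒≤ k<p)) p∣[p-k]!)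

-- The Frobenius map x ↦ x ^ q of K = GF(q³), q = p ^ (n + 1).
--
-- It is a ring endomorphism (K has characteristic p, so (x + y) ^ p =
-- x ^ p + y ^ p), it commutes with every integer polynomial, and its
-- third power is the identity (x ^ q³ = x).

module Frobenius (p n : ℕ) (pr : Prime p) (𝔽 : FiniteField ((p ℕ.^ suc n) ℕ.^ 3)) where
  open FieldAlgebra 𝔽
  open IntegerSolver 𝔽 using (fromℕ; fromℤ; Polynomial; op; [+]; [*]; con; var; _:^_; :-_; ⟦_⟧)
  open Counting 𝔽 using (fromℕ-order; pow-order)
  open PrimeBinomial p pr using (p∣pCk)
  open Geometry 𝔽 (p ℕ.^ suc n) using (frob)
  open import Data.Nat.Divisibility using (divides)
  open import Data.Nat.Combinatorics using (_C_; nCn≡1; nCk≡nC[n∸k])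
  open import Algebra.Properties.Semiring.Mult.TCOptimised semiring using (×ᵤ≈×; ×1-homo-*)
  open import Algebra.Properties.Semiring.Mult semiring using (×-assoc-*) renaming (_×_ to _×ᵤ_)
  open import Algebra.Properties.CommutativeSemiring.Binomial (CommutativeRing.commutativeSemiring commutativeRing)
    using (binomialExpansion; theorem)
  open import Algebra.Properties.Monoid.Sum (CommutativeRing.+-monoid commutativeRing)
    using (sum; sum-init-last; sum-cong-≗; sum-replicate-zero)
  open ≡-Reasoning

  private instance
    p≢0 : ℕ.NonZero p
    p≢0 = prime⇒nonZero pr

  fromℕ-* : ∀ m k → fromℕ (m ℕ.* k) ≡ fromℕ m * fromℕ k
  fromℕ-* = ×1-homo-*

  fromℕ-^ : ∀ m k → fromℕ (m ℕ.^ k) ≡ fromℕ m ^ k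
  fromℕ-^ m zero    = refl
  fromℕ-^ m (suc k) = trans (fromℕ-* m (m ℕ.^ k)) (cong (fromℕ m *_) (fromℕ-^ m k))

  -- K has characteristic p: 0 = N · 1 = (p · 1) ^ (3 (n + 1)).
  characteristic : fromℕ p ≡ 0#
  characteristic = ^-≡0 (fromℕ p) (suc n) (trans (sym (fromℕ-^ p (suc n)))
                     (^-≡0 (fromℕ (p ℕ.^ suc n)) 3 (trans (sym (fromℕ-^ (p ℕ.^ suc n) 3)) fromℕ-order)))

  ×ᵤ-as-* : ∀ c z → c ×ᵤ z ≡ fromℕ c * z
  ×ᵤ-as-* c z = begin
    c ×ᵤ z           ≡⟨ cong (c ×ᵤ_) (sym (*-identityˡ z)) ⟩
    c ×ᵤ (1# * z)    ≡⟨ sym (×-assoc-* c 1# z) ⟩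
    (c ×ᵤ 1#) * z    ≡⟨ cong (_* z) (×ᵤ≈× c 1#) ⟩
    fromℕ c * z      ∎

  module BinomialTerms (x y : K) (P : ℕ) where
    monomial term : Fin (suc P) → K
    monomial k = (x ^ₛ Fin.toℕ k) * (y ^ₛ (P ∸ Fin.toℕ k))
    term k = (P C Fin.toℕ k) ×ᵤ monomial k

    first-term : term Fin.zero ≡ y ^ P
    first-term = begin
      (P C 0) ×ᵤ (1# * y ^ₛ P)   ≡⟨ cong (_×ᵤ (1# * y ^ₛ P)) (trans (nCk≡nC[n∸k] {0} {P} ℕ.z≤n) (nCn≡1 P)) ⟩
      (1# * y ^ₛ P) + 0#         ≡⟨ +-identityʳ _ ⟩
      1# * y ^ₛ P                ≡⟨ *-identityˡ _ ⟩
      y ^ₛ P                     ≡⟨ sym (^-agrees y P) ⟩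
      y ^ P                      ∎

    last-term : term (Fin.fromℕ P) ≡ x ^ P
    last-term = begin
      term (Fin.fromℕ P)                          ≡⟨ cong (λ k → (P C k) ×ᵤ ((x ^ₛ k) * (y ^ₛ (P ∸ k)))) (FinP.toℕ-fromℕ P) ⟩
      (P C P) ×ᵤ ((x ^ₛ P) * (y ^ₛ (P ∸ P)))     ≡⟨ cong₂ (λ c e → c ×ᵤ ((x ^ₛ P) * (y ^ₛ e))) (nCn≡1 P) (ℕP.n∸n≡0 P) ⟩
      ((x ^ₛ P) * 1#) + 0#                        ≡⟨ +-identityʳ _ ⟩
      (x ^ₛ P) * 1#                               ≡⟨ *-identityʳ _ ⟩
      x ^ₛ P                                      ≡⟨ sym (^-agrees x P) ⟩
      x ^ P                                       ∎

  binomial-twoTerms : ∀ P → .{{ℕ.NonZero P}} → (∀ k → 0 ℕ.< k → k ℕ.< P → fromℕ (P C k) ≡ 0#) →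
                      ∀ x y → (x + y) ^ P ≡ x ^ P + y ^ P
  binomial-twoTerms P@(suc m) inner≡0 x y = begin
    (x + y) ^ P                                  ≡⟨ ^-agrees (x + y) P ⟩
    (x + y) ^ₛ P                                 ≡⟨ theorem P x y ⟩
    binomialExpansion x y P                      ≡⟨ cong (term Fin.zero +_) (sum-init-last (λ i → term (Fin.suc i))) ⟩
    term Fin.zero + (sum (λ i → term (Fin.suc (Fin.inject₁ i))) + term (Fin.fromℕ P))
      ≡⟨ cong₂ (λ u v → term Fin.zero + (u + v)) (trans (sum-cong-≗ inner-term≡0) (sum-replicate-zero m)) last-term ⟩
    term Fin.zero + (0# + x ^ P)                 ≡⟨ cong₂ _+_ first-term (+-identityˡ (x ^ P)) ⟩
    y ^ P + x ^ P                                ≡⟨ +-comm (y ^ P) (x ^ P) ⟩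
    x ^ P + y ^ P                                ∎
    where
    open BinomialTerms x y P
    inner-term≡0 : ∀ (i : Fin m) → term (Fin.suc (Fin.inject₁ i)) ≡ 0#
    inner-term≡0 i = begin
      term j                      ≡⟨ ×ᵤ-as-* (P C k) (monomial j) ⟩
      fromℕ (P C k) * monomial j  ≡⟨ cong (_* monomial j) (inner≡0 k (ℕ.s≤s ℕ.z≤n) k<P) ⟩
      0# * monomial j             ≡⟨ zeroˡ (monomial j) ⟩
      0#                          ∎
      where
      j = Fin.suc (Fin.inject₁ i)
      k = Fin.toℕ j
      k<P : k ℕ.< P
      k<P = ℕ.s≤s (subst (ℕ._< m) (sym (FinP.toℕ-inject₁ i)) (FinP.toℕ<n i))

  ^p-+ : ∀ x y → (x + y) ^ p ≡ x ^ p + y ^ p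
  ^p-+ = binomial-twoTerms p inner≡0
    where
    inner≡0 : ∀ k → 0 ℕ.< k → k ℕ.< p → fromℕ (p C k) ≡ 0#
    inner≡0 k 0<k k<p with p∣pCk k 0<k k<p
    ... | divides t pCk≡t*p = begin
      fromℕ (p C k)        ≡⟨ cong fromℕ pCk≡t*p ⟩
      fromℕ (t ℕ.* p)      ≡⟨ fromℕ-* t p ⟩
      fromℕ t * fromℕ p    ≡⟨ cong (fromℕ t *_) characteristic ⟩
      fromℕ t * 0#         ≡⟨ zeroʳ _ ⟩
      0#                   ∎

  ^pᵏ-+ : ∀ k x y → (x + y) ^ (p ℕ.^ k) ≡ x ^ (p ℕ.^ k) + y ^ (p ℕ.^ k)
  ^pᵏ-+ zero    x y = trans (*-identityʳ (x + y)) (sym (cong₂ _+_ (*-identityʳ x) (*-identityʳ y)))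
  ^pᵏ-+ (suc k) x y = begin
    (x + y) ^ (p ℕ.* p ℕ.^ k)                      ≡⟨ ^-* (x + y) p (p ℕ.^ k) ⟩
    ((x + y) ^ p) ^ (p ℕ.^ k)                      ≡⟨ cong (_^ (p ℕ.^ k)) (^p-+ x y) ⟩
    (x ^ p + y ^ p) ^ (p ℕ.^ k)                    ≡⟨ ^pᵏ-+ k (x ^ p) (y ^ p) ⟩
    (x ^ p) ^ (p ℕ.^ k) + (y ^ p) ^ (p ℕ.^ k)      ≡⟨ sym (cong₂ _+_ (^-* x p (p ℕ.^ k)) (^-* y p (p ℕ.^ k))) ⟩
    x ^ (p ℕ.* p ℕ.^ k) + y ^ (p ℕ.* p ℕ.^ k)      ∎

  frob-+ : ∀ x y → frob (x + y) ≡ frob x + frob y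
  frob-+ = ^pᵏ-+ (suc n)

  frob-* : ∀ x y → frob (x * y) ≡ frob x * frob y
  frob-* x y = *-^ x y (p ℕ.^ suc n)

  frob-1 : frob 1# ≡ 1#
  frob-1 = one-power (p ℕ.^ suc n)
    where
    one-power : ∀ k → 1# ^ k ≡ 1#
    one-power zero    = refl
    one-power (suc k) = trans (*-identityˡ _) (one-power k)

  frob-0 : frob 0# ≡ 0#
  frob-0 = zero-power (p ℕ.^ suc n) {{ℕP.m^n≢0 p (suc n)}}
    where
    zero-power : ∀ k → .{{ℕ.NonZero k}} → 0# ^ k ≡ 0#
    zero-power (suc k) = zeroˡ _

  frob-neg : ∀ x → frob (- x) ≡ - frob x
  frob-neg x = inverseʳ-unique (frob x) (frob (- x))
                 (trans (sym (frob-+ x (- x))) (trans (cong frob (-‿inverseʳ x)) frob-0))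

  frob-fromℕ : ∀ k → frob (fromℕ k) ≡ fromℕ k
  frob-fromℕ zero          = frob-0
  frob-fromℕ (suc zero)    = frob-1
  frob-fromℕ (suc (suc k)) = trans (frob-+ (fromℕ (suc k)) 1#) (cong₂ _+_ (frob-fromℕ (suc k)) frob-1)

  frob-fromℤ : ∀ c → frob (fromℤ c) ≡ fromℤ c
  frob-fromℤ (⁺ k)     = frob-fromℕ k
  frob-fromℤ -[1+ k ]  = trans (frob-neg _) (cong -_ (frob-fromℕ (suc k)))

  frob-⟦⟧ : ∀ {m} (e : Polynomial m) ρ → frob (⟦ e ⟧ ρ) ≡ ⟦ e ⟧ (Vec.map frob ρ)
  frob-⟦⟧ (op [+] e e′) ρ = trans (frob-+ _ _) (cong₂ _+_ (frob-⟦⟧ e ρ) (frob-⟦⟧ e′ ρ))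
  frob-⟦⟧ (op [*] e e′) ρ = trans (frob-* _ _) (cong₂ _*_ (frob-⟦⟧ e ρ) (frob-⟦⟧ e′ ρ))
  frob-⟦⟧ (con c)       ρ = frob-fromℤ c
  frob-⟦⟧ (var i)       ρ = sym (VecP.lookup-map i frob ρ)
  frob-⟦⟧ (e :^ k)      ρ = trans (frob-power (⟦ e ⟧ ρ) k) (cong (_^ₛ k) (frob-⟦⟧ e ρ))
    where
    frob-power : ∀ x k → frob (x ^ₛ k) ≡ frob x ^ₛ k
    frob-power x zero    = frob-1
    frob-power x (suc k) = trans (frob-* x (x ^ₛ k)) (cong (frob x *_) (frob-power x k))
  frob-⟦⟧ (:- e)        ρ = trans (frob-neg _) (cong -_ (frob-⟦⟧ e ρ))

  frob³ : ∀ x → frob (frob (frob x)) ≡ x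
  frob³ x = begin
    ((x ^ q) ^ q) ^ q       ≡⟨ cong (_^ q) (sym (^-* x q q)) ⟩
    (x ^ (q ℕ.* q)) ^ q     ≡⟨ sym (^-* x (q ℕ.* q) q) ⟩
    x ^ (q ℕ.* q ℕ.* q)     ≡⟨ cong (x ^_) (trans (ℕP.*-assoc q q q) (cong (λ r → q ℕ.* (q ℕ.* r)) (sym (ℕP.*-identityʳ q)))) ⟩
    x ^ (q ℕ.^ 3)           ≡⟨ pow-order x ⟩
    x                       ∎
    where q = p ℕ.^ suc n

-- Points of the projective plane over K.
--
-- Nonzero vectors X, Y represent the same point iff X ∥ Y, i.e. their
-- cross product vanishes.

module ProjectivePlane {N : ℕ} (𝔽 : FiniteField N) (q : ℕ) where
  open FieldAlgebra 𝔽
  open Geometry 𝔽 q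
  open Identities 𝔽 q
  open ≡-Reasoning

  infix 4 _∥_
  _∥_ : V3 → V3 → Set
  X ∥ Y = cross X Y ≡ 0ᵛ

  scale-0ᵛ : ∀ t → scale t 0ᵛ ≡ 0ᵛ
  scale-0ᵛ t = vec-≡ (zeroʳ t) (zeroʳ t) (zeroʳ t)

  scale-scale : ∀ s t X → scale s (scale t X) ≡ scale (s * t) X
  scale-scale s t (x₁ , x₂ , x₃) = vec-≡ (sym (*-assoc s t x₁)) (sym (*-assoc s t x₂)) (sym (*-assoc s t x₃))

  scale-cancel : ∀ {t} X → t ≢ 0# → scale t X ≡ 0ᵛ → X ≡ 0ᵛ
  scale-cancel (x₁ , x₂ , x₃) t≢0 tX≡0 =
    vec-≡ (*-cancel-≡0 t≢0 (cong proj₁ tX≡0)) (*-cancel-≡0 t≢0 (cong (proj₁ ∘ proj₂) tX≡0))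
          (*-cancel-≡0 t≢0 (cong (proj₂ ∘ proj₂) tX≡0))

  ∥-sym : ∀ {X Y} → X ∥ Y → Y ∥ X
  ∥-sym {X} {Y} X∥Y = trans (cross-antisym X Y) (trans (cong (scale (- 1#)) X∥Y) (scale-0ᵛ (- 1#)))

  proportional⇒∥ : ∀ {u v X Y} → u ≢ 0# → scale u X ≡ scale v Y → Y ∥ X
  proportional⇒∥ {u} {v} {X} {Y} u≢0 uX≡vY = scale-cancel (cross Y X) (*-nonzero u≢0 u≢0) (begin
    scale (u * u) (cross Y X)           ≡⟨ sym (cross-scale u u Y X) ⟩
    cross (scale u Y) (scale u X)       ≡⟨ cong (cross (scale u Y)) uX≡vY ⟩
    cross (scale u Y) (scale v Y)       ≡⟨ cross-scale u v Y Y ⟩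
    scale (u * v) (cross Y Y)           ≡⟨ cong (scale (u * v)) (cross-self Y) ⟩
    scale (u * v) 0ᵛ                    ≡⟨ scale-0ᵛ (u * v) ⟩
    0ᵛ                                  ∎)

  -- Conversely, X ∥ Y with Y ≢ 0 gives s X = t Y with s ≢ 0: take for s, t
  -- corresponding coordinates of Y and X, with that of Y nonzero.
  ∥⇒proportional : ∀ X Y → X ∥ Y → Y ≢ 0ᵛ → Σ K λ s → Σ K λ t → s ≢ 0# × scale s X ≡ scale t Y
  ∥⇒proportional (x₁ , x₂ , x₃) (y₁ , y₂ , y₃) X∥Y =
    from-minors (cong proj₁ X∥Y) (cong (proj₁ ∘ proj₂) X∥Y) (cong (proj₂ ∘ proj₂) X∥Y)
    where
    swapped : ∀ {xⱼ yₖ xₖ yⱼ} → xⱼ * yₖ - xₖ * yⱼ ≡ 0# → yₖ * xⱼ ≡ xₖ * yⱼ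
    swapped minor≡0 = trans (*-comm _ _) (x∙y⁻¹≈ε⇒x≈y _ _ minor≡0)
    swapped′ : ∀ {xⱼ yₖ xₖ yⱼ} → xₖ * yⱼ - xⱼ * yₖ ≡ 0# → yₖ * xⱼ ≡ xₖ * yⱼ
    swapped′ minor≡0 = trans (*-comm _ _) (sym (x∙y⁻¹≈ε⇒x≈y _ _ minor≡0))

    from-minors : x₂ * y₃ - x₃ * y₂ ≡ 0# → x₃ * y₁ - x₁ * y₃ ≡ 0# → x₁ * y₂ - x₂ * y₁ ≡ 0# →
                  (y₁ , y₂ , y₃) ≢ 0ᵛ → Σ K λ s → Σ K λ t → s ≢ 0# × scale s (x₁ , x₂ , x₃) ≡ scale t (y₁ , y₂ , y₃)
    from-minors m₁ m₂ m₃ Y≢0 with y₁ ≟ 0# | y₂ ≟ 0# | y₃ ≟ 0#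
    ... | no y₁≢0 | _       | _       = y₁ , x₁ , y₁≢0 , vec-≡ (*-comm y₁ x₁) (swapped′ m₃) (swapped m₂)
    ... | yes _   | no y₂≢0 | _       = y₂ , x₂ , y₂≢0 , vec-≡ (swapped m₃) (*-comm y₂ x₂) (swapped′ m₁)
    ... | yes _   | yes _   | no y₃≢0 = y₃ , x₃ , y₃≢0 , vec-≡ (swapped′ m₂) (swapped m₁) (*-comm y₃ x₃)
    ... | yes y₁≡0 | yes y₂≡0 | yes y₃≡0 = ⊥-elim (Y≢0 (vec-≡ y₁≡0 y₂≡0 y₃≡0))

  ∥-vanish : ∀ Q {X Y} → X ∥ Y → Y ≢ 0ᵛ → eval Q Y ≡ 0# → eval Q X ≡ 0#
  ∥-vanish Q {X} {Y} X∥Y Y≢0 QY≡0 with ∥⇒proportional X Y X∥Y Y≢0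
  ... | s , t , s≢0 , sX≡tY = *-cancel-≡0 (*-nonzero s≢0 s≢0) (begin
    (s * s) * eval Q X   ≡⟨ sym (eval-scale Q s X) ⟩
    eval Q (scale s X)   ≡⟨ cong (eval Q) sX≡tY ⟩
    eval Q (scale t Y)   ≡⟨ eval-scale Q t Y ⟩
    (t * t) * eval Q Y   ≡⟨ cong ((t * t) *_) QY≡0 ⟩
    (t * t) * 0#         ≡⟨ zeroʳ (t * t) ⟩
    0#                   ∎)

  ∥-trans : ∀ {X Y Z} → X ∥ Z → Y ∥ Z → Z ≢ 0ᵛ → X ∥ Y
  ∥-trans {X} {Y} {Z} X∥Z Y∥Z Z≢0 with ∥⇒proportional X Z X∥Z Z≢0 | ∥⇒proportional Y Z Y∥Z Z≢0
  ... | s , t , s≢0 , sX≡tZ | s′ , t′ , s′≢0 , s′Y≡t′Z = scale-cancel (cross X Y) (*-nonzero s≢0 s′≢0) (begin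
    scale (s * s′) (cross X Y)         ≡⟨ sym (cross-scale s s′ X Y) ⟩
    cross (scale s X) (scale s′ Y)     ≡⟨ cong₂ cross sX≡tZ s′Y≡t′Z ⟩
    cross (scale t Z) (scale t′ Z)     ≡⟨ cross-scale t t′ Z Z ⟩
    scale (t * t′) (cross Z Z)         ≡⟨ cong (scale (t * t′)) (cross-self Z) ⟩
    scale (t * t′) 0ᵛ                  ≡⟨ scale-0ᵛ (t * t′) ⟩
    0ᵛ                                 ∎)

  ∥⇒det≡0 : ∀ {X Y} Z → X ∥ Y → det3 X Y Z ≡ 0#
  ∥⇒det≡0 {X} {Y} Z@(z₁ , z₂ , z₃) X∥Y = begin
    det3 X Y Z            ≡⟨ det-tripleProduct X Y Z ⟩
    dot (cross X Y) Z     ≡⟨ cong (λ V → dot V Z) X∥Y ⟩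
    dot 0ᵛ Z              ≡⟨ cong₂ _+_ (cong₂ _+_ (zeroˡ z₁) (zeroˡ z₂)) (zeroˡ z₃) ⟩
    0# + 0# + 0#          ≡⟨ trans (+-identityʳ (0# + 0#)) (+-identityʳ 0#) ⟩
    0#                    ∎

  det≢0⇒nonzero : ∀ {X Y Z} → det3 X Y Z ≢ 0# → X ≢ 0ᵛ × Y ≢ 0ᵛ × Z ≢ 0ᵛ
  det≢0⇒nonzero {X} {Y} {Z} det≢0 =
    (λ { refl → det≢0 (det-0ᵛ₁ Y Z) }) , (λ { refl → det≢0 (det-0ᵛ₂ X Z) }) , (λ { refl → det≢0 (det-0ᵛ₃ X Y) })

  Proportional : K → Form → Form → Set
  Proportional t Q R = (a R ≡ t * a Q) × (b R ≡ t * b Q) × (c R ≡ t * c Q)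
                     × (f R ≡ t * f Q) × (g R ≡ t * g Q) × (h R ≡ t * h Q)

  values⇒proportional : ∀ t Q R → (∀ X → eval R X ≡ t * eval Q X) → Proportional t Q R
  values⇒proportional t Q R R≡tQ =
      square-term (coefficient-a R) (coefficient-a Q) (R≡tQ _)
    , square-term (coefficient-b R) (coefficient-b Q) (R≡tQ _)
    , square-term (coefficient-c R) (coefficient-c Q) (R≡tQ _)
    , mixed-term (coefficient-f R) (coefficient-f Q) (R≡tQ _) (R≡tQ _) (R≡tQ _)
    , mixed-term (coefficient-g R) (coefficient-g Q) (R≡tQ _) (R≡tQ _) (R≡tQ _)
    , mixed-term (coefficient-h R) (coefficient-h Q) (R≡tQ _) (R≡tQ _) (R≡tQ _)
    where
    square-term : ∀ {r q′ u v} → r ≡ u → q′ ≡ v → u ≡ t * v → r ≡ t * q′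
    square-term r≡u q≡v u≡tv = trans r≡u (trans u≡tv (cong (t *_) (sym q≡v)))
    mixed-term : ∀ {r q′ u₁ u₂ u₃ v₁ v₂ v₃} → r ≡ u₁ - u₂ - u₃ → q′ ≡ v₁ - v₂ - v₃ →
                 u₁ ≡ t * v₁ → u₂ ≡ t * v₂ → u₃ ≡ t * v₃ → r ≡ t * q′
    mixed-term {v₁ = v₁} {v₂} {v₃} r≡ q≡ e₁ e₂ e₃ = begin
      _                                  ≡⟨ r≡ ⟩
      _ - _ - _                          ≡⟨ cong₂ _-_ (cong₂ _-_ e₁ e₂) e₃ ⟩
      t * v₁ - t * v₂ - t * v₃           ≡⟨ cong (_- t * v₃) (sym (x[y-z]≈xy-xz t v₁ v₂)) ⟩
      t * (v₁ - v₂) - t * v₃             ≡⟨ sym (x[y-z]≈xy-xz t (v₁ - v₂) v₃) ⟩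
      t * (v₁ - v₂ - v₃)                 ≡⟨ cong (t *_) (sym q≡) ⟩
      t * _                              ∎

  -- A form is determined by its values on the image of an invertible matrix
  -- (every point is, up to the factor det M, such an image: Cramer's rule).
  values-on-image : ∀ t Q R M → matDet M ≢ 0# → (∀ W → eval R (mulV M W) ≡ t * eval Q (mulV M W)) →
                    ∀ X → eval R X ≡ t * eval Q X
  values-on-image t Q R M M≢0 on-image X = *-cancelˡ (*-nonzero D≢0 D≢0) (begin
    (D * D) * eval R X             ≡⟨ sym (eval-scale R D X) ⟩
    eval R (scale D X)             ≡⟨ cong (eval R) (sym (cramer A B C X)) ⟩
    eval R (mulV M W)              ≡⟨ on-image W ⟩
    t * eval Q (mulV M W)          ≡⟨ cong (λ Y → t * eval Q Y) (cramer A B C X) ⟩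
    t * eval Q (scale D X)         ≡⟨ cong (t *_) (eval-scale Q D X) ⟩
    t * ((D * D) * eval Q X)       ≡⟨ x∙yz≈y∙xz t (D * D) (eval Q X) ⟩
    (D * D) * (t * eval Q X)       ∎)
    where
    A B C : V3
    A = M 0F 0F , M 1F 0F , M 2F 0F
    B = M 0F 1F , M 1F 1F , M 2F 1F
    C = M 0F 2F , M 1F 2F , M 2F 2F
    D = det3 A B C
    D≢0 : D ≢ 0#
    D≢0 D≡0 = M≢0 (trans (matDet-columns A B C) D≡0)
    W = coords A B C X

  V3-≟ : DecidableEquality V3
  V3-≟ = ×-≡-dec _≟_ (×-≡-dec _≟_ _≟_)

  AllNonzero : V3 → Set
  AllNonzero (x , y , z) = x ≢ 0# × y ≢ 0# × z ≢ 0#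

  AllNonzero⇒nonzero : ∀ {X} → AllNonzero X → X ≢ 0ᵛ
  AllNonzero⇒nonzero (x≢0 , _ , _) X≡0 = x≢0 (cong proj₁ X≡0)

  orthogonal⇒∥ : ∀ {F G U} → dot F U ≡ 0# → dot G U ≡ 0# → U ∥ cross F G
  orthogonal⇒∥ {F@(f₁ , f₂ , f₃)} {G@(g₁ , g₂ , g₃)} {U} F·U≡0 G·U≡0 = begin
    cross U (cross F G)                          ≡⟨ cross-cross U F G ⟩
    scale (dot G U) F -ᵛ scale (dot F U) G       ≡⟨ cong₂ (λ s t → scale s F -ᵛ scale t G) G·U≡0 F·U≡0 ⟩
    scale 0# F -ᵛ scale 0# G                     ≡⟨ vec-≡ (zeros f₁ g₁) (zeros f₂ g₂) (zeros f₃ g₃) ⟩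
    0ᵛ                                           ∎
    where
    zeros : ∀ x y → 0# * x - 0# * y ≡ 0#
    zeros x y = trans (cong₂ _-_ (zeroˡ x) (zeroˡ y)) (-‿inverseʳ 0#)

  pairProducts-∥ : ∀ {X Y} → AllNonzero X → AllNonzero Y → pairProducts X ∥ pairProducts Y → Y ∥ X
  pairProducts-∥ {X@(x₁ , x₂ , x₃)} {Y@(y₁ , y₂ , y₃)} (x₁≢0 , x₂≢0 , x₃≢0) (y₁≢0 , y₂≢0 , y₃≢0) ∥ =
    vec-≡ (*-cancel-≡0 (*-nonzero x₁≢0 y₁≢0) (cong proj₁ product≡0))
          (*-cancel-≡0 (*-nonzero x₂≢0 y₂≢0) (cong (proj₁ ∘ proj₂) product≡0))
          (*-cancel-≡0 (*-nonzero x₃≢0 y₃≢0) (cong (proj₂ ∘ proj₂) product≡0))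
    where
    product≡0 : componentwise (componentwise X Y) (cross Y X) ≡ 0ᵛ
    product≡0 = trans (sym (cross-pairProducts X Y)) ∥

  factors-nonzero : ∀ x y z → x * y * z ≢ 0# → AllNonzero (x , y , z)
  factors-nonzero x y z xyz≢0 =
      (λ x≡0 → xyz≢0 (trans (cong (λ u → u * y * z) x≡0) (trans (cong (_* z) (zeroˡ y)) (zeroˡ z))))
    , (λ y≡0 → xyz≢0 (trans (cong (λ u → x * u * z) y≡0) (trans (cong (_* z) (zeroʳ x)) (zeroˡ z))))
    , (λ z≡0 → xyz≢0 (trans (cong (x * y *_) z≡0) (zeroʳ (x * y))))

  -- Conics through the vertices of a triangle A, B, C, in the coordinates of
  -- the frame A, B, C.
  module Frame (A B C : V3) (D≢0 : det3 A B C ≢ 0#) where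
    D : K
    D = det3 A B C

    T : Mat
    T = columns A B C

    coordinates : V3 → V3
    coordinates = coords A B C

    ThroughVertices : Form → Set
    ThroughVertices Q = (eval Q A ≡ 0#) × (eval Q B ≡ 0#) × (eval Q C ≡ 0#)

    -- In frame coordinates a form through the vertices has no square
    -- terms; its remaining coefficients are:
    mixedCoefficients : Form → V3
    mixedCoefficients Q = f (pull Q T) , g (pull Q T) , h (pull Q T)

    -- The square coefficients of pull Q T are, definitionally, Q(A), Q(B), Q(C).
    pull-throughVertices : ∀ Q → ThroughVertices Q →
                           pull Q T ≡ form 0# 0# 0# (f (pull Q T)) (g (pull Q T)) (h (pull Q T))
    pull-throughVertices Q (QA≡0 , QB≡0 , QC≡0) = form-≡ QA≡0 QB≡0 QC≡0 refl refl refl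

    eval-inFrame : ∀ Q → ThroughVertices Q → ∀ X →
                   (D * D) * eval Q X ≡ dot (mixedCoefficients Q) (pairProducts (coordinates X))
    eval-inFrame Q through X = begin
      (D * D) * eval Q X                     ≡⟨ sym (eval-scale Q D X) ⟩
      eval Q (scale D X)                     ≡⟨ cong (eval Q) (sym (cramer A B C X)) ⟩
      eval Q (mulV T (coordinates X))        ≡⟨ sym (eval-pull Q T (coordinates X)) ⟩
      eval (pull Q T) (coordinates X)        ≡⟨ cong (λ R → eval R (coordinates X)) (pull-throughVertices Q through) ⟩
      eval (form 0# 0# 0# (f (pull Q T)) (g (pull Q T)) (h (pull Q T))) (coordinates X)
                                             ≡⟨ eval-noSquares _ _ _ (coordinates X) ⟩
      dot (mixedCoefficients Q) (pairProducts (coordinates X)) ∎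

    onConic-inFrame : ∀ Q → ThroughVertices Q → ∀ {X} → eval Q X ≡ 0# →
                      dot (mixedCoefficients Q) (pairProducts (coordinates X)) ≡ 0#
    onConic-inFrame Q through {X} QX≡0 =
      trans (sym (eval-inFrame Q through X)) (trans (cong ((D * D) *_) QX≡0) (zeroʳ (D * D)))

    mixedCoefficients-nonzero : ∀ Q → ThroughVertices Q → disc Q ≢ 0# → AllNonzero (mixedCoefficients Q)
    mixedCoefficients-nonzero Q through disc≢0 = factors-nonzero _ _ _ (λ fgh≡0 →
      *-nonzero (*-nonzero T≢0 T≢0) disc≢0 (begin
        (matDet T * matDet T) * disc Q                          ≡⟨ sym (disc-pull Q T) ⟩
        disc (pull Q T)                                         ≡⟨ cong disc (pull-throughVertices Q through) ⟩
        disc (form 0# 0# 0# (f (pull Q T)) (g (pull Q T)) (h (pull Q T)))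
                                                                ≡⟨ disc-noSquares _ _ _ ⟩
        f (pull Q T) * g (pull Q T) * h (pull Q T)              ≡⟨ fgh≡0 ⟩
        0#                                                      ∎))
      where
      T≢0 : matDet T ≢ 0#
      T≢0 T≡0 = D≢0 (trans (sym (matDet-columns A B C)) T≡0)

    AtVertex : V3 → Set
    AtVertex (α , β , γ) = (β ≡ 0# × γ ≡ 0#) ⊎ (α ≡ 0# × γ ≡ 0#) ⊎ (α ≡ 0# × β ≡ 0#)

    IsVertex : V3 → Set
    IsVertex X = A ∥ X ⊎ B ∥ X ⊎ C ∥ X

    vertex-or-generic : ∀ F W → AllNonzero F → dot F (pairProducts W) ≡ 0# → AtVertex W ⊎ AllNonzero W
    vertex-or-generic F (α , β , γ) (f≢0 , g≢0 , h≢0) onConic with α ≟ 0# | β ≟ 0# | γ ≟ 0#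
    ... | yes α≡0  | yes β≡0  | _        = inj₁ (inj₂ (inj₂ (α≡0 , β≡0)))
    ... | yes α≡0  | no  _    | yes γ≡0  = inj₁ (inj₂ (inj₁ (α≡0 , γ≡0)))
    ... | yes refl | no  β≢0  | no  γ≢0  =
      ⊥-elim (*-nonzero f≢0 (*-nonzero β≢0 γ≢0) (trans (sym (dot-pairProducts₁ F β γ)) onConic))
    ... | no  _    | yes β≡0  | yes γ≡0  = inj₁ (inj₁ (β≡0 , γ≡0))
    ... | no  α≢0  | yes refl | no  γ≢0  =
      ⊥-elim (*-nonzero g≢0 (*-nonzero α≢0 γ≢0) (trans (sym (dot-pairProducts₂ F α γ)) onConic))
    ... | no  α≢0  | no  β≢0  | yes refl =
      ⊥-elim (*-nonzero h≢0 (*-nonzero α≢0 β≢0) (trans (sym (dot-pairProducts₃ F α β)) onConic))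
    ... | no  α≢0  | no  β≢0  | no  γ≢0  = inj₂ (α≢0 , β≢0 , γ≢0)

    atVertex⇒isVertex : ∀ X → AtVertex (coordinates X) → IsVertex X
    atVertex⇒isVertex X (inj₁ (β≡0 , γ≡0)) = inj₁ (proportional⇒∥ D≢0 (begin
      scale D X                                ≡⟨ sym (cramer A B C X) ⟩
      mulV T (coordinates X)                   ≡⟨ cong₂ (λ β γ → mulV T (det3 X B C , β , γ)) β≡0 γ≡0 ⟩
      mulV T (det3 X B C , 0# , 0#)            ≡⟨ columns-first A B C _ ⟩
      scale (det3 X B C) A                     ∎))
    atVertex⇒isVertex X (inj₂ (inj₁ (α≡0 , γ≡0))) = inj₂ (inj₁ (proportional⇒∥ D≢0 (begin
      scale D X                                ≡⟨ sym (cramer A B C X) ⟩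
      mulV T (coordinates X)                   ≡⟨ cong₂ (λ α γ → mulV T (α , det3 A X C , γ)) α≡0 γ≡0 ⟩
      mulV T (0# , det3 A X C , 0#)            ≡⟨ columns-second A B C _ ⟩
      scale (det3 A X C) B                     ∎)))
    atVertex⇒isVertex X (inj₂ (inj₂ (α≡0 , β≡0))) = inj₂ (inj₂ (proportional⇒∥ D≢0 (begin
      scale D X                                ≡⟨ sym (cramer A B C X) ⟩
      mulV T (coordinates X)                   ≡⟨ cong₂ (λ α β → mulV T (α , β , det3 A B X)) α≡0 β≡0 ⟩
      mulV T (0# , 0# , det3 A B X)            ≡⟨ columns-third A B C _ ⟩
      scale (det3 A B X) C                     ∎)))

    coordinates-∥ : ∀ X Y → coordinates Y ∥ coordinates X → coordinates X ≢ 0ᵛ → X ∥ Y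
    coordinates-∥ X Y WY∥WX WX≢0 with ∥⇒proportional (coordinates Y) (coordinates X) WY∥WX WX≢0
    ... | s , t , s≢0 , sWY≡tWX = proportional⇒∥ (*-nonzero s≢0 D≢0) (begin
      scale (s * D) Y                          ≡⟨ sym (scale-scale s D Y) ⟩
      scale s (scale D Y)                      ≡⟨ cong (scale s) (sym (cramer A B C Y)) ⟩
      scale s (mulV T (coordinates Y))         ≡⟨ sym (mulV-scale T s (coordinates Y)) ⟩
      mulV T (scale s (coordinates Y))         ≡⟨ cong (mulV T) sWY≡tWX ⟩
      mulV T (scale t (coordinates X))         ≡⟨ mulV-scale T t (coordinates X) ⟩
      scale t (mulV T (coordinates X))         ≡⟨ cong (scale t) (cramer A B C X) ⟩
      scale t (scale D X)                      ≡⟨ scale-scale t D X ⟩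
      scale (t * D) X                          ∎)

    same-conic : ∀ Q₁ Q₂ → ThroughVertices Q₁ → ThroughVertices Q₂ →
                 let F₁ = mixedCoefficients Q₁ ; F₂ = mixedCoefficients Q₂ in
                 ∀ {s t} → s ≢ 0# → AllNonzero F₂ → scale s F₂ ≡ scale t F₁ → SameConic Q₁ Q₂
    same-conic Q₁ Q₂ through₁ through₂ {s} {t} s≢0 F₂≢0 sF₂≡tF₁ =
      s⁻¹ * t , *-nonzero s⁻¹≢0 t≢0 , values⇒proportional (s⁻¹ * t) Q₁ Q₂ Q₂≡λQ₁
      where
      F₁ = mixedCoefficients Q₁
      F₂ = mixedCoefficients Q₂
      s⁻¹ = proj₁ (inverse s s≢0)
      s*s⁻¹ : s * s⁻¹ ≡ 1#
      s*s⁻¹ = proj₂ (inverse s s≢0)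
      s⁻¹≢0 : s⁻¹ ≢ 0#
      s⁻¹≢0 s⁻¹≡0 = 0≢1 (trans (sym (trans (cong (s *_) s⁻¹≡0) (zeroʳ s))) s*s⁻¹)
      t≢0 : t ≢ 0#
      t≢0 t≡0 = AllNonzero⇒nonzero F₂≢0 (scale-cancel F₂ s≢0 (trans sF₂≡tF₁ (begin
        scale t F₁       ≡⟨ cong (λ u → scale u F₁) t≡0 ⟩
        scale 0# F₁      ≡⟨ vec-≡ (zeroˡ _) (zeroˡ _) (zeroˡ _) ⟩
        0ᵛ               ∎)))

      s-Q₂≡t-Q₁ : ∀ X → s * eval Q₂ X ≡ t * eval Q₁ X
      s-Q₂≡t-Q₁ X = *-cancelˡ (*-nonzero D≢0 D≢0) (begin
        (D * D) * (s * eval Q₂ X)                        ≡⟨ x∙yz≈y∙xz (D * D) s (eval Q₂ X) ⟩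
        s * ((D * D) * eval Q₂ X)                        ≡⟨ cong (s *_) (eval-inFrame Q₂ through₂ X) ⟩
        s * dot F₂ (pairProducts (coordinates X))        ≡⟨ sym (dot-scale s F₂ _) ⟩
        dot (scale s F₂) (pairProducts (coordinates X))  ≡⟨ cong (λ V → dot V (pairProducts (coordinates X))) sF₂≡tF₁ ⟩
        dot (scale t F₁) (pairProducts (coordinates X))  ≡⟨ dot-scale t F₁ _ ⟩
        t * dot F₁ (pairProducts (coordinates X))        ≡⟨ cong (t *_) (sym (eval-inFrame Q₁ through₁ X)) ⟩
        t * ((D * D) * eval Q₁ X)                        ≡⟨ x∙yz≈y∙xz t (D * D) (eval Q₁ X) ⟩
        (D * D) * (t * eval Q₁ X)                        ∎)

      Q₂≡λQ₁ : ∀ X → eval Q₂ X ≡ (s⁻¹ * t) * eval Q₁ X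
      Q₂≡λQ₁ X = begin
        eval Q₂ X                      ≡⟨ sym (*-identityˡ (eval Q₂ X)) ⟩
        1# * eval Q₂ X                 ≡⟨ cong (_* eval Q₂ X) (sym (trans (*-comm s⁻¹ s) s*s⁻¹)) ⟩
        (s⁻¹ * s) * eval Q₂ X          ≡⟨ *-assoc s⁻¹ s (eval Q₂ X) ⟩
        s⁻¹ * (s * eval Q₂ X)          ≡⟨ cong (s⁻¹ *_) (s-Q₂≡t-Q₁ X) ⟩
        s⁻¹ * (t * eval Q₁ X)          ≡⟨ sym (*-assoc s⁻¹ t (eval Q₁ X)) ⟩
        (s⁻¹ * t) * eval Q₁ X          ∎

    -- Two nondegenerate conics through the vertices which share two
    -- further points X, Y are equal, unless X or Y is a vertex or X ∥ Y
    -- (two distinct conics meet in at most four points).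
    common-points : ∀ Q₁ Q₂ → ThroughVertices Q₁ → ThroughVertices Q₂ → disc Q₁ ≢ 0# → disc Q₂ ≢ 0# →
                    ∀ {X Y} → eval Q₁ X ≡ 0# → eval Q₂ X ≡ 0# → eval Q₁ Y ≡ 0# → eval Q₂ Y ≡ 0# →
                    SameConic Q₁ Q₂ ⊎ IsVertex X ⊎ IsVertex Y ⊎ X ∥ Y
    common-points Q₁ Q₂ through₁ through₂ disc₁≢0 disc₂≢0 {X} {Y} Q₁X Q₂X Q₁Y Q₂Y =
      by-cases (V3-≟ (cross F₂ F₁) 0ᵛ)
      where
      F₁ = mixedCoefficients Q₁
      F₂ = mixedCoefficients Q₂
      F₁≢0 = mixedCoefficients-nonzero Q₁ through₁ disc₁≢0
      F₂≢0 = mixedCoefficients-nonzero Q₂ through₂ disc₂≢0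

      -- If F₂ ∦ F₁, the pairProducts of points off the triangle sides are
      -- all parallel to F₂ × F₁, so there is only one such point.
      off-sides : AllNonzero (coordinates X) → AllNonzero (coordinates Y) → ¬ F₂ ∥ F₁ → X ∥ Y
      off-sides WX≢0 WY≢0 F₂∦F₁ = coordinates-∥ X Y WY∥WX (AllNonzero⇒nonzero WX≢0)
        where
        UX∥G = orthogonal⇒∥ {F₂} {F₁} (onConic-inFrame Q₂ through₂ Q₂X) (onConic-inFrame Q₁ through₁ Q₁X)
        UY∥G = orthogonal⇒∥ {F₂} {F₁} (onConic-inFrame Q₂ through₂ Q₂Y) (onConic-inFrame Q₁ through₁ Q₁Y)
        WY∥WX = pairProducts-∥ WX≢0 WY≢0 (∥-trans UX∥G UY∥G F₂∦F₁)

      non-proportional : AtVertex (coordinates X) ⊎ AllNonzero (coordinates X) →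
                         AtVertex (coordinates Y) ⊎ AllNonzero (coordinates Y) →
                         ¬ F₂ ∥ F₁ → IsVertex X ⊎ IsVertex Y ⊎ X ∥ Y
      non-proportional (inj₁ X-atVertex) _                 _     = inj₁ (atVertex⇒isVertex X X-atVertex)
      non-proportional (inj₂ _)          (inj₁ Y-atVertex) _     = inj₂ (inj₁ (atVertex⇒isVertex Y Y-atVertex))
      non-proportional (inj₂ WX≢0)       (inj₂ WY≢0)       F₂∦F₁ = inj₂ (inj₂ (off-sides WX≢0 WY≢0 F₂∦F₁))

      proportional : F₂ ∥ F₁ → SameConic Q₁ Q₂
      proportional F₂∥F₁ = same-conic Q₁ Q₂ through₁ through₂ s≢0 F₂≢0 sF₂≡tF₁
        where
        proportion = ∥⇒proportional F₂ F₁ F₂∥F₁ (AllNonzero⇒nonzero F₁≢0)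
        s≢0 = proj₁ (proj₂ (proj₂ proportion))
        sF₂≡tF₁ = proj₂ (proj₂ (proj₂ proportion))

      by-cases : Dec (F₂ ∥ F₁) → SameConic Q₁ Q₂ ⊎ IsVertex X ⊎ IsVertex Y ⊎ X ∥ Y
      by-cases (yes F₂∥F₁) = inj₁ (proportional F₂∥F₁)
      by-cases (no  F₂∦F₁) = inj₂ (non-proportional
        (vertex-or-generic F₁ (coordinates X) F₁≢0 (onConic-inFrame Q₁ through₁ Q₁X))
        (vertex-or-generic F₁ (coordinates Y) F₁≢0 (onConic-inFrame Q₁ through₁ Q₁Y)) F₂∦F₁)

-- The collineation σ and the images B^M of a circumscribed bundle B.

module CircumscribedBundles (p n : ℕ) (pr : Prime p) (𝔽 : FiniteField ((p ℕ.^ suc n) ℕ.^ 3)) where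
  open FieldAlgebra 𝔽
  open IntegerSolver 𝔽 using (Polynomial; var; ⟦_⟧; module ℰ; matrix; π₁; π₂; π₃)
  open Geometry 𝔽 (p ℕ.^ suc n)
  open Identities 𝔽 (p ℕ.^ suc n)
  open ProjectivePlane 𝔽 (p ℕ.^ suc n)
  open Frobenius p n pr 𝔽
  open ≡-Reasoning

  frobForm : Form → Form
  frobForm Q = form (frob (a Q)) (frob (b Q)) (frob (c Q)) (frob (f Q)) (frob (g Q)) (frob (h Q))

  conic-fixed : ∀ {Q} → IsConic Q → frobForm Q ≡ Q
  conic-fixed (a-fixed , b-fixed , c-fixed , f-fixed , g-fixed , h-fixed , _) =
    form-≡ a-fixed b-fixed c-fixed f-fixed g-fixed h-fixed

  Fixed : Mat → Set
  Fixed M = ∀ i j → InSub (M i j)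

  entries : Mat → Vec K 9
  entries M = M 0F 0F ∷ M 0F 1F ∷ M 0F 2F ∷ M 1F 0F ∷ M 1F 1F ∷ M 1F 2F ∷ M 2F 0F ∷ M 2F 1F ∷ M 2F 2F ∷ []

  frob-entries : ∀ {M} → Fixed M → Vec.map frob (entries M) ≡ entries M
  frob-entries fixed =
    cong₂ _∷_ (fixed 0F 0F) (cong₂ _∷_ (fixed 0F 1F) (cong₂ _∷_ (fixed 0F 2F) (
    cong₂ _∷_ (fixed 1F 0F) (cong₂ _∷_ (fixed 1F 1F) (cong₂ _∷_ (fixed 1F 2F) (
    cong₂ _∷_ (fixed 2F 0F) (cong₂ _∷_ (fixed 2F 1F) (cong₂ _∷_ (fixed 2F 2F) refl))))))))

  -- σ commutes with matrices over GF(q), with cross products and with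
  -- changes of coordinates over GF(q) in a form; each is an instance of
  -- frob-⟦⟧ (variables: the entries of M first).
  σ-mulV : ∀ {M} → Fixed M → ∀ X → σ (mulV M X) ≡ mulV M (σ X)
  σ-mulV {M} fixed X@(x , y , z) = vec-≡ (component π₁) (component π₂) (component π₃)
    where
    Mᴱ = matrix (var (# 0)) (var (# 1)) (var (# 2)) (var (# 3)) (var (# 4)) (var (# 5)) (var (# 6)) (var (# 7)) (var (# 8))
    Xᴱ = var (# 9) , var (# 10) , var (# 11)
    ρ = entries M Vec.++ (x ∷ y ∷ z ∷ [])
    component : (π : ℰ.Vec3 → Polynomial 12) →
                frob (⟦ π (ℰ.mulV Mᴱ Xᴱ) ⟧ ρ) ≡ ⟦ π (ℰ.mulV Mᴱ Xᴱ) ⟧ (entries M Vec.++ (frob x ∷ frob y ∷ frob z ∷ []))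
    component π = trans (frob-⟦⟧ (π (ℰ.mulV Mᴱ Xᴱ)) ρ)
                        (cong (λ ρ′ → ⟦ π (ℰ.mulV Mᴱ Xᴱ) ⟧ (ρ′ Vec.++ Vec.map frob (x ∷ y ∷ z ∷ []))) (frob-entries fixed))

  σ-cross : ∀ X Y → σ (cross X Y) ≡ cross (σ X) (σ Y)
  σ-cross (x₁ , x₂ , x₃) (y₁ , y₂ , y₃) = vec-≡ (frob-⟦⟧ (π₁ Zᴱ) ρ) (frob-⟦⟧ (π₂ Zᴱ) ρ) (frob-⟦⟧ (π₃ Zᴱ) ρ)
    where
    Zᴱ = ℰ.cross (var (# 0) , var (# 1) , var (# 2)) (var (# 3) , var (# 4) , var (# 5))
    ρ = x₁ ∷ x₂ ∷ x₃ ∷ y₁ ∷ y₂ ∷ y₃ ∷ []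

  σ-∥ : ∀ {X Y} → X ∥ Y → σ X ∥ σ Y
  σ-∥ {X} {Y} X∥Y = begin
    cross (σ X) (σ Y)    ≡⟨ sym (σ-cross X Y) ⟩
    σ (cross X Y)        ≡⟨ cong σ X∥Y ⟩
    σ 0ᵛ                 ≡⟨ vec-≡ frob-0 frob-0 frob-0 ⟩
    0ᵛ                   ∎

  frob-pull : ∀ Q {M} → Fixed M → frobForm (pull Q M) ≡ pull (frobForm Q) M
  frob-pull Q {M} fixed = form-≡ (coefficient ℰ.Form.a) (coefficient ℰ.Form.b) (coefficient ℰ.Form.c)
                                 (coefficient ℰ.Form.f) (coefficient ℰ.Form.g) (coefficient ℰ.Form.h)
    where
    Mᴱ = matrix (var (# 0)) (var (# 1)) (var (# 2)) (var (# 3)) (var (# 4)) (var (# 5)) (var (# 6)) (var (# 7)) (var (# 8))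
    Qᴱ = ℰ.form (var (# 9)) (var (# 10)) (var (# 11)) (var (# 12)) (var (# 13)) (var (# 14))
    coefficients : Form → Vec K 6
    coefficients R = a R ∷ b R ∷ c R ∷ f R ∷ g R ∷ h R ∷ []
    coefficient : (sel : ℰ.Form → Polynomial 15) →
                  frob (⟦ sel (ℰ.pull Qᴱ Mᴱ) ⟧ (entries M Vec.++ coefficients Q)) ≡
                  ⟦ sel (ℰ.pull Qᴱ Mᴱ) ⟧ (entries M Vec.++ coefficients (frobForm Q))
    coefficient sel = trans (frob-⟦⟧ (sel (ℰ.pull Qᴱ Mᴱ)) (entries M Vec.++ coefficients Q))
                            (cong (λ ρ′ → ⟦ sel (ℰ.pull Qᴱ Mᴱ) ⟧ (ρ′ Vec.++ Vec.map frob (coefficients Q))) (frob-entries fixed))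

  disc-nonzero : ∀ {Q M} → IsConic (pull Q M) → disc Q ≢ 0#
  disc-nonzero {Q} {M} (_ , _ , _ , _ , _ , _ , disc≢0) discQ≡0 =
    disc≢0 (trans (disc-pull Q M) (trans (cong ((matDet M * matDet M) *_) discQ≡0) (zeroʳ _)))

  -- Whether Q becomes a conic of PG(2,q) after a change of coordinates in
  -- GL(3,q) does not depend on the matrix: Q itself is then σ-fixed.
  conic-transfer : ∀ Q {M₁ M₂} → InGL M₁ → InGL M₂ → IsConic (pull Q M₁) → IsConic (pull Q M₂)
  conic-transfer Q {M₁} {M₂} (fixed₁ , det₁≢0) (fixed₂ , det₂≢0) conic₁ =
    cong a pull₂-fixed , cong b pull₂-fixed , cong c pull₂-fixed ,
    cong f pull₂-fixed , cong g pull₂-fixed , cong h pull₂-fixed , disc₂≢0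
    where
    values : ∀ X → eval (frobForm Q) X ≡ 1# * eval Q X
    values = values-on-image 1# Q (frobForm Q) M₁ det₁≢0 (λ W → begin
      eval (frobForm Q) (mulV M₁ W)   ≡⟨ sym (eval-pull (frobForm Q) M₁ W) ⟩
      eval (pull (frobForm Q) M₁) W   ≡⟨ cong (λ R → eval R W) (sym (frob-pull Q fixed₁)) ⟩
      eval (frobForm (pull Q M₁)) W   ≡⟨ cong (λ R → eval R W) (conic-fixed conic₁) ⟩
      eval (pull Q M₁) W              ≡⟨ eval-pull Q M₁ W ⟩
      eval Q (mulV M₁ W)              ≡⟨ sym (*-identityˡ _) ⟩
      1# * eval Q (mulV M₁ W)         ∎)

    Q-fixed : frobForm Q ≡ Q
    Q-fixed = let (a≡ , b≡ , c≡ , f≡ , g≡ , h≡) = values⇒proportional 1# Q (frobForm Q) values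
              in form-≡ (unit a≡) (unit b≡) (unit c≡) (unit f≡) (unit g≡) (unit h≡)
      where
      unit : ∀ {x y} → x ≡ 1# * y → x ≡ y
      unit {y = y} x≡1y = trans x≡1y (*-identityˡ y)

    pull₂-fixed : frobForm (pull Q M₂) ≡ pull Q M₂
    pull₂-fixed = trans (frob-pull Q fixed₂) (cong (λ R → pull R M₂) Q-fixed)

    disc₂≢0 : disc (pull Q M₂) ≢ 0#
    disc₂≢0 disc≡0 = *-nonzero (*-nonzero det₂≢0 det₂≢0) (disc-nonzero {Q} {M₁} conic₁) (trans (sym (disc-pull Q M₂)) disc≡0)

  module Triangle (P : V3) (nc : NonCollinear P (σ P) (σ (σ P))) where
    vertex : Fin 3 → V3
    vertex 0F = P
    vertex 1F = σ P
    vertex 2F = σ (σ P)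

    next : Fin 3 → Fin 3
    next 0F = 1F
    next 1F = 2F
    next 2F = 0F

    -- σ permutes the vertices cyclically, since σ³ = 1.
    σ-vertex : ∀ i → σ (vertex i) ≡ vertex (next i)
    σ-vertex 0F = refl
    σ-vertex 1F = refl
    σ-vertex 2F = vec-≡ (frob³ _) (frob³ _) (frob³ _)

    image : Mat → Fin 3 → V3
    image M i = mulV M (vertex i)

    σ-image : ∀ {M} → Fixed M → ∀ i → σ (image M i) ≡ image M (next i)
    σ-image {M} fixed i = trans (σ-mulV {M} fixed (vertex i)) (cong (mulV M) (σ-vertex i))

    image-nondegenerate : ∀ {M} → InGL M → det3 (image M 0F) (image M 1F) (image M 2F) ≢ 0#
    image-nondegenerate {M} (_ , det≢0) det≡0 =
      *-nonzero det≢0 nc (trans (sym (det-mulV M P (σ P) (σ (σ P)))) det≡0)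

    image-nonzero : ∀ {M} → InGL M → ∀ i → image M i ≢ 0ᵛ
    image-nonzero {M} gl 0F = proj₁ (det≢0⇒nonzero (image-nondegenerate {M} gl))
    image-nonzero {M} gl 1F = proj₁ (proj₂ (det≢0⇒nonzero (image-nondegenerate {M} gl)))
    image-nonzero {M} gl 2F = proj₂ (proj₂ (det≢0⇒nonzero (image-nondegenerate {M} gl)))

    inImage⇒vanishes : ∀ {M Q} → InImage P M Q → ∀ i → eval Q (image M i) ≡ 0#
    inImage⇒vanishes {M} {Q} (_ , Q₀ , _ , _) 0F = trans (sym (eval-pull Q M P)) Q₀
    inImage⇒vanishes {M} {Q} (_ , _ , Q₁ , _) 1F = trans (sym (eval-pull Q M (σ P))) Q₁
    inImage⇒vanishes {M} {Q} (_ , _ , _ , Q₂) 2F = trans (sym (eval-pull Q M (σ (σ P)))) Q₂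

    vanishes⇒inImage : ∀ {M Q} → IsConic (pull Q M) → (∀ i → eval Q (image M i) ≡ 0#) → InImage P M Q
    vanishes⇒inImage {M} {Q} conic vanishes =
      conic , trans (eval-pull Q M P) (vanishes 0F) , trans (eval-pull Q M (σ P)) (vanishes 1F) ,
      trans (eval-pull Q M (σ (σ P))) (vanishes 2F)

    -- If two images share a vertex, applying σ shows that they share all
    -- their vertices.
    nextⁿ : ℕ → Fin 3 → Fin 3
    nextⁿ zero    i = i
    nextⁿ (suc k) i = next (nextⁿ k i)

    distance : ∀ j j′ → Σ ℕ λ k → nextⁿ k j ≡ j′
    distance 0F 0F = 0 , refl
    distance 0F 1F = 1 , refl
    distance 0F 2F = 2 , refl
    distance 1F 0F = 2 , refl
    distance 1F 1F = 0 , refl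
    distance 1F 2F = 1 , refl
    distance 2F 0F = 1 , refl
    distance 2F 1F = 2 , refl
    distance 2F 2F = 0 , refl

    all-vertices-shared : ∀ {M M′} → Fixed M → Fixed M′ → ∀ {i j} → image M i ∥ image M′ j →
                          ∀ j′ → Σ (Fin 3) λ i′ → image M i′ ∥ image M′ j′
    all-vertices-shared {M} {M′} fixed fixed′ {i} {j} shared j′ =
      nextⁿ k i , subst (λ j″ → image M (nextⁿ k i) ∥ image M′ j″) (proj₂ (distance j j′)) (shift k)
      where
      k = proj₁ (distance j j′)
      shift : ∀ k → image M (nextⁿ k i) ∥ image M′ (nextⁿ k j)
      shift zero    = shared
      shift (suc k) = subst₂ _∥_ (σ-image {M} fixed (nextⁿ k i)) (σ-image {M′} fixed′ (nextⁿ k j)) (σ-∥ (shift k))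

    inclusion : ∀ {M M′} → InGL M → InGL M′ → ∀ {i j} → image M i ∥ image M′ j →
                ∀ Q → InImage P M Q → InImage P M′ Q
    inclusion {M} {M′} gl gl′ {i} {j} shared Q Q∈B =
      vanishes⇒inImage {M′} {Q} (conic-transfer Q {M} {M′} gl gl′ (proj₁ Q∈B)) vanishes
      where
      vanishes : ∀ j′ → eval Q (image M′ j′) ≡ 0#
      vanishes j′ = ∥-vanish Q (∥-sym (proj₂ common)) (image-nonzero {M} gl (proj₁ common))
                             (inImage⇒vanishes {M} {Q} Q∈B (proj₁ common))
        where common = all-vertices-shared {M} {M′} (proj₁ gl) (proj₁ gl′) {i} {j} shared j′

    shared-vertex⇒same-bundle : ∀ {M₁ M₂} → InGL M₁ → InGL M₂ → ∀ {i j} → image M₁ i ∥ image M₂ j →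
                                ∀ Q → (InImage P M₁ Q → InImage P M₂ Q) × (InImage P M₂ Q → InImage P M₁ Q)
    shared-vertex⇒same-bundle {M₁} {M₂} gl₁ gl₂ {i} {j} shared Q =
      inclusion {M₁} {M₂} gl₁ gl₂ {i} {j} shared Q , inclusion {M₂} {M₁} gl₂ gl₁ {j} {i} (∥-sym shared) Q

    module ImageFrame (M : Mat) (gl : InGL M) = Frame (image M 0F) (image M 1F) (image M 2F) (image-nondegenerate {M} gl)

    inImage⇒throughVertices : ∀ M (gl : InGL M) {Q} → InImage P M Q → ImageFrame.ThroughVertices M gl Q
    inImage⇒throughVertices M gl {Q} Q∈B =
      inImage⇒vanishes {M} {Q} Q∈B 0F , inImage⇒vanishes {M} {Q} Q∈B 1F , inImage⇒vanishes {M} {Q} Q∈B 2F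

    no-shared-vertex : ∀ {M₁ M₂} (gl₁ : InGL M₁) (gl₂ : InGL M₂) →
                       ¬ (∀ Q → (InImage P M₁ Q → InImage P M₂ Q) × (InImage P M₂ Q → InImage P M₁ Q)) →
                       ∀ j → ¬ ImageFrame.IsVertex M₁ gl₁ (image M₂ j)
    no-shared-vertex {M₁} {M₂} gl₁ gl₂ distinct j (inj₁ shared) =
      distinct (shared-vertex⇒same-bundle {M₁} {M₂} gl₁ gl₂ {0F} {j} shared)
    no-shared-vertex {M₁} {M₂} gl₁ gl₂ distinct j (inj₂ (inj₁ shared)) =
      distinct (shared-vertex⇒same-bundle {M₁} {M₂} gl₁ gl₂ {1F} {j} shared)
    no-shared-vertex {M₁} {M₂} gl₁ gl₂ distinct j (inj₂ (inj₂ shared)) =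
      distinct (shared-vertex⇒same-bundle {M₁} {M₂} gl₁ gl₂ {2F} {j} shared)

-- B^{M₁} and B^{M₂} consist of the conics through the triangles U = M₁ Δ
-- and V = M₂ Δ, Δ = (P, σ P, σ² P).  If they differ, no vertex of V is a
-- vertex of U; so two common conics pass through U₀, U₁, U₂, V₀, V₁, with
-- V₀, V₁ distinct and off the triangle U, and are therefore equal.

open import Data.Nat using (_^_)

corollary3p7 : (p n : ℕ) → Prime p →
    (𝔽 : FiniteField ((p ^ suc n) ^ 3)) →
    let open Geometry 𝔽 (p ^ suc n)
    in (P : V3) → NonCollinear P (σ P) (σ (σ P)) →
       (M₁ M₂ : Mat) → InGL M₁ → InGL M₂ →
       ¬ (∀ Q → (InImage P M₁ Q → InImage P M₂ Q) × (InImage P M₂ Q → InImage P M₁ Q)) →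
       ∀ Q₁ Q₂ → InImage P M₁ Q₁ → InImage P M₂ Q₁ →
       InImage P M₁ Q₂ → InImage P M₂ Q₂ → SameConic Q₁ Q₂
corollary3p7 p n pr 𝔽 P nc M₁ M₂ gl₁ gl₂ distinct Q₁ Q₂ Q₁∈B₁ Q₁∈B₂ Q₂∈B₁ Q₂∈B₂ =
  conclude (common-points Q₁ Q₂ (inImage⇒throughVertices M₁ gl₁ Q₁∈B₁) (inImage⇒throughVertices M₁ gl₁ Q₂∈B₁)
                          (disc-nonzero {Q₁} {M₁} (proj₁ Q₁∈B₁)) (disc-nonzero {Q₂} {M₁} (proj₁ Q₂∈B₁))
                          (inImage⇒vanishes {M₂} {Q₁} Q₁∈B₂ 0F) (inImage⇒vanishes {M₂} {Q₂} Q₂∈B₂ 0F)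
                          (inImage⇒vanishes {M₂} {Q₁} Q₁∈B₂ 1F) (inImage⇒vanishes {M₂} {Q₂} Q₂∈B₂ 1F))
  where
  open Geometry 𝔽 (p ^ suc n) using (SameConic)
  open ProjectivePlane 𝔽 (p ^ suc n) using (_∥_; ∥⇒det≡0)
  open CircumscribedBundles p n pr 𝔽 using (disc-nonzero; module Triangle)
  open Triangle P nc
  open ImageFrame M₁ gl₁ using (common-points; IsVertex)

  conclude : SameConic Q₁ Q₂ ⊎ IsVertex (image M₂ 0F) ⊎ IsVertex (image M₂ 1F) ⊎ image M₂ 0F ∥ image M₂ 1F →
             SameConic Q₁ Q₂
  conclude (inj₁ same)                    = same
  conclude (inj₂ (inj₁ V₀-vertex))        = ⊥-elim (no-shared-vertex gl₁ gl₂ distinct 0F V₀-vertex)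
  conclude (inj₂ (inj₂ (inj₁ V₁-vertex))) = ⊥-elim (no-shared-vertex gl₁ gl₂ distinct 1F V₁-vertex)
  conclude (inj₂ (inj₂ (inj₂ V₀∥V₁)))     = ⊥-elim (image-nondegenerate {M₂} gl₂ (∥⇒det≡0 (image M₂ 2F) V₀∥V₁))
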